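{- Let $n\ge 1$ be an integer not divisible by $3$. Then \[ C_{3,n}(q,t)=\sum_{s=0}^{\lfloor n/3 \rfloor}\ \sum_{\substack{a,d\geq s\\ a+s+d+1=n}}q^d t^a=\sum_{s=0}^{\lfloor n/3 \rfloor}\ \sum_{a=s}^{n-2s-1}q^{n-a-s-1}t^a, \] where the inner sums range over non-negative integers $a,d$.
   Context: A $(3,n)$-Dyck path is a lattice path from $(0,0)$ to $(3,n)$ using unit north and east steps that stays weakly above the line $y=\frac{n}{3}x$. The rectangle $[0,3]\times[0,n]$ is divided into unit cells; the cell $(a,b)$ (column $a\in\{1,2,3\}$ from left, row $b\in\{1,\dots,n\}$ from bottom) is $[a-1,a]\times[b-1,b]$. For a $(3,n)$-Dyck path $\Pi$, let $\lambda(\Pi)$ be the set of cells of the rectangle lying above (north-west of) the path $\Pi$. $\operatorname{area}(\Pi)$ is the number of cells lying entirely between the path $\Pi$ and the line $y=\frac{n}{3}x$ (below the path and above the diagonal). For $x\in\lambda(\Pi)$, $\operatorname{arm}(x)$ (resp. $\operatorname{leg}(x)$) is the number of cells of $\lambda(\Pi)$ strictly east of $x$ in the same row (resp. strictly south of $x$ in the same column). $\operatorname{dinv}(\Pi)$ is the number of cells $x\in\lambda(\Pi)$ with $\frac{\operatorname{arm}(x)}{\operatorname{leg}(x)+1}<\frac{3}{n}<\frac{\operatorname{arm}(x)+1}{\operatorname{leg}(x)}$ (the right-hand fraction is $+\infty$ when $\operatorname{leg}(x)=0$). The rational $q,t$-Catalan polynomial is $C_{3,n}(q,t)=\sum_{\Pi}q^{\operatorname{dinv}(\Pi)}t^{\operatorname{area}(\Pi)}$,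 summed over all $(3,n)$-Dyck paths $\Pi$. -}

module Defs where

open import Data.Bool using (Bool; true; false; _∧_; not)
open import Data.Nat using (ℕ; zero; suc; _+_; _*_; _∸_; _/_; _≤ᵇ_; _<ᵇ_; _≡ᵇ_)
open import Data.Product using (_×_; _,_)
open import Data.List using (List; []; _∷_; map; _++_; concatMap; filterᵇ; length; upTo)

data Step : Set where
  N E : Step

words : ℕ → List (List Step)
words zero    = [] ∷ []
words (suc k) = map (N ∷_) (words k) ++ map (E ∷_) (words k)

countE : List Step → ℕ
countE []       = 0
countE (N ∷ s) = countE s
countE (E ∷ s) = suc (countE s)

countN : List Step → ℕ
countN []       = 0
countN (N ∷ s) = suc (countN s)
countN (E ∷ s) = countN s

-- every lattice point (e , k) visited (starting at the current point) satisfies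
-- k ≥ (n/3) e, i.e. n * e ≤ 3 * k  (weakly above y = (n/3) x)
aboveFrom : ℕ → ℕ → ℕ → List Step → Bool
aboveFrom n e k []       = n * e ≤ᵇ 3 * k
aboveFrom n e k (N ∷ s) = (n * e ≤ᵇ 3 * k) ∧ aboveFrom n e (suc k) s
aboveFrom n e k (E ∷ s) = (n * e ≤ᵇ 3 * k) ∧ aboveFrom n (suc e) k s

isDyck : ℕ → List Step → Bool
isDyck n p = (countE p ≡ᵇ 3) ∧ (countN p ≡ᵇ n) ∧ aboveFrom n 0 0 p

dyckPaths : ℕ → List (List Step)
dyckPaths n = filterᵇ (isDyck n) (words (n + 3))

eastHeights : ℕ → List Step → List ℕ
eastHeights k []       = []
eastHeights k (N ∷ s) = eastHeights (suc k) s
eastHeights k (E ∷ s) = k ∷ eastHeights k s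

nth : List ℕ → ℕ → ℕ
nth []       _       = 0
nth (x ∷ xs) zero    = x
nth (x ∷ xs) (suc i) = nth xs i

-- height of the path along column a (a ∈ {1,2,3}): the east step [a-1,a] is at this height
colHeight : List Step → ℕ → ℕ
colHeight p a = nth (eastHeights 0 p) (a ∸ 1)

range1 : ℕ → List ℕ
range1 m = map suc (upTo m)

countᵇ : {A : Set} → (A → Bool) → List A → ℕ
countᵇ f xs = length (filterᵇ f xs)

cells : ℕ → List (ℕ × ℕ)
cells n = concatMap (λ a → map (λ b → (a , b)) (range1 n)) (range1 3)

-- cell (a , b) = [a-1,a]×[b-1,b] lies above (north-west of) the path
inLambda : List Step → ℕ → ℕ → Bool
inLambda p a b = colHeight p a <ᵇ b

arm : ℕ → List Step → ℕ → ℕ → ℕ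
arm n p a b = countᵇ (λ a' → (a <ᵇ a') ∧ inLambda p a' b) (range1 3)

leg : ℕ → List Step → ℕ → ℕ → ℕ
leg n p a b = countᵇ (λ b' → (b' <ᵇ b) ∧ inLambda p a b') (range1 n)

-- arm/(leg+1) < 3/n < (arm+1)/leg, cross-multiplied (n ≥ 1; leg = 0 gives +∞ on the right,
-- and then 3*leg < n*(arm+1) holds automatically)
dinvCell : ℕ → List Step → ℕ × ℕ → Bool
dinvCell n p (a , b) =
  inLambda p a b ∧ ((n * arm n p a b) <ᵇ (3 * (leg n p a b + 1)))
                 ∧ ((3 * leg n p a b) <ᵇ (n * (arm n p a b + 1)))

dinv : ℕ → List Step → ℕ
dinv n p = countᵇ (dinvCell n p) (cells n)

-- cell (a , b) is below the path and entirely (weakly) above y = (n/3) x,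
-- i.e. its lower-right corner (a , b-1) satisfies n*a ≤ 3*(b-1)
areaCell : ℕ → List Step → ℕ × ℕ → Bool
areaCell n p (a , b) = not (inLambda p a b) ∧ (n * a ≤ᵇ 3 * (b ∸ 1))

area : ℕ → List Step → ℕ
area n p = countᵇ (areaCell n p) (cells n)

-- A polynomial in q,t with non-negative integer coefficients, as a list of monomials
-- q^i t^j encoded as (i , j); the coefficient of q^i t^j is the multiplicity.
Poly : Set
Poly = List (ℕ × ℕ)

coeff : Poly → ℕ → ℕ → ℕ
coeff P i j = countᵇ (λ { (x , y) → (x ≡ᵇ i) ∧ (y ≡ᵇ j) }) P

catalan3 : ℕ → Poly
catalan3 n = map (λ p → (dinv n p , area n p)) (dyckPaths n)

range0 : ℕ → List ℕ
range0 m = upTo (suc m)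

rhs1 : ℕ → Poly
rhs1 n = concatMap (λ s →
           concatMap (λ a →
             map (λ d → (d , a))
               (filterᵇ (λ d → (s ≤ᵇ a) ∧ (s ≤ᵇ d) ∧ (a + s + d + 1 ≡ᵇ n)) (range0 n)))
             (range0 n))
         (range0 (n / 3))

-- Σ_{s=0}^{⌊n/3⌋} Σ_{a=s}^{n-2s-1} q^{n-a-s-1} t^a   (upper limit as an integer: a + 2s + 1 ≤ n)
rhs2 : ℕ → Poly
rhs2 n = concatMap (λ s →
           map (λ a → (n ∸ a ∸ s ∸ 1 , a))
             (filterᵇ (λ a → (s ≤ᵇ a) ∧ (a + 2 * s + 1 ≤ᵇ n)) (range0 n)))
         (range0 (n / 3))

-- A (3,n)-Dyck path is determined by the heights h₁ ≤ h₂ of its first two east steps (the third is at height n),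
-- subject to 3h₁ ≥ n and 3h₂ ≥ 2n.  Write n = 3m + 1 + e with e ∈ {0,1}, m' = 2m + e, x = h₂ − h₁ and y = n − h₂;
-- the paths are then the pairs with y ≤ m and x + y ≤ m', with area (m' − x − y) + (m − y) and
-- dinv = min(x, m + 1) + #{v < y | m ≤ x + v} + y.  In each of the three regimes x + y ≤ m ("shallow"),
-- x ≤ m < x + y ("crossing") and m < x ("wide") the map to s = n − 1 − area − dinv, a = area is injective, and
-- for fixed s the shallow paths give a ∈ [m' − s, n − 2s − 1] while the crossing and wide ones fill [s, m' − s)
-- alternately by parity.  This is the bijection onto the index set of the right-hand side.

module Submission where

open import Data.Bool using (Bool; true; false; _∧_; not; T)
open import Data.Bool.Properties using (∧-assoc)
open import Data.Empty using (⊥-elim)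
open import Data.List using (List; []; _∷_; map; _++_; concatMap; filterᵇ; upTo; applyUpTo; replicate)
open import Data.Nat
open import Data.Nat.Properties
open import Data.Nat.DivMod using (m≡m%n+[m/n]*n; m%n<n)
open import Data.Nat.Divisibility using (_∣_; divides)
open import Data.Nat.Tactic.RingSolver using (solve-∀)
open import Data.Product using (_×_; _,_; proj₁; proj₂; ∃₂)
open import Relation.Binary.PropositionalEquality
open import Relation.Nullary using (¬_; yes; no)
open import Defs

ind : Bool → ℕ
ind true  = 1
ind false = 0

bool-ext : {a b : Bool} → (T a → T b) → (T b → T a) → a ≡ b
bool-ext {false} {false} _ _ = refl
bool-ext {false} {true}  _ g = ⊥-elim (g _)
bool-ext {true}  {false} f _ = ⊥-elim (f _)
bool-ext {true}  {true}  _ _ = refl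

∧-intro : {a b : Bool} → T a → T b → T (a ∧ b)
∧-intro {true} {true} _ _ = _

∧-l : {a b : Bool} → T (a ∧ b) → T a
∧-l {true} _ = _

∧-r : {a b : Bool} → T (a ∧ b) → T b
∧-r {true} t = t

T-not→¬T : {b : Bool} → T (not b) → ¬ T b
T-not→¬T {false} _ ()

¬T→T-not : {b : Bool} → ¬ T b → T (not b)
¬T→T-not {false} _ = _
¬T→T-not {true}  f = f _

T⇒≡true : {a : Bool} → T a → a ≡ true
T⇒≡true {true} _ = refl

¬T⇒≡false : {a : Bool} → ¬ T a → a ≡ false
¬T⇒≡false {false} _ = refl
¬T⇒≡false {true}  f = ⊥-elim (f _)

ind-true : {a : Bool} → T a → ind a ≡ 1
ind-true t = cong ind (T⇒≡true t)

ind-false : {a : Bool} → ¬ T a → ind a ≡ 0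
ind-false f = cong ind (¬T⇒≡false f)

module _ {A : Set} where

  countᵇ-∷ : (g : A → Bool) (x : A) (xs : List A) → countᵇ g (x ∷ xs) ≡ ind (g x) + countᵇ g xs
  countᵇ-∷ g x xs with g x
  ... | true  = refl
  ... | false = refl

  countᵇ-++ : (g : A → Bool) (xs ys : List A) → countᵇ g (xs ++ ys) ≡ countᵇ g xs + countᵇ g ys
  countᵇ-++ g []       ys = refl
  countᵇ-++ g (x ∷ xs) ys = begin
    countᵇ g (x ∷ (xs ++ ys))                ≡⟨ countᵇ-∷ g x (xs ++ ys) ⟩
    ind (g x) + countᵇ g (xs ++ ys)          ≡⟨ cong (ind (g x) +_) (countᵇ-++ g xs ys) ⟩
    ind (g x) + (countᵇ g xs + countᵇ g ys)  ≡⟨ +-assoc (ind (g x)) _ _ ⟨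
    ind (g x) + countᵇ g xs + countᵇ g ys    ≡⟨ cong (_+ countᵇ g ys) (countᵇ-∷ g x xs) ⟨
    countᵇ g (x ∷ xs) + countᵇ g ys          ∎
    where open ≡-Reasoning

  countᵇ-cong : {f g : A → Bool} (xs : List A) → (∀ x → f x ≡ g x) → countᵇ f xs ≡ countᵇ g xs
  countᵇ-cong []                   _ = refl
  countᵇ-cong {f} {g} (x ∷ xs) f≗g = begin
    countᵇ f (x ∷ xs)          ≡⟨ countᵇ-∷ f x xs ⟩
    ind (f x) + countᵇ f xs    ≡⟨ cong₂ _+_ (cong ind (f≗g x)) (countᵇ-cong xs f≗g) ⟩
    ind (g x) + countᵇ g xs    ≡⟨ countᵇ-∷ g x xs ⟨
    countᵇ g (x ∷ xs)          ∎
    where open ≡-Reasoning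

  countᵇ-filterᵇ : (h g : A → Bool) (xs : List A) → countᵇ g (filterᵇ h xs) ≡ countᵇ (λ x → h x ∧ g x) xs
  countᵇ-filterᵇ h g []       = refl
  countᵇ-filterᵇ h g (x ∷ xs) = trans (head x xs) (sym (countᵇ-∷ (λ x → h x ∧ g x) x xs))
    where
    head : ∀ x xs → countᵇ g (filterᵇ h (x ∷ xs)) ≡ ind (h x ∧ g x) + countᵇ (λ x → h x ∧ g x) xs
    head x xs with h x
    ... | true  = trans (countᵇ-∷ g x _) (cong (ind (g x) +_) (countᵇ-filterᵇ h g xs))
    ... | false = countᵇ-filterᵇ h g xs

module _ {A B : Set} where

  countᵇ-map : (g : B → Bool) (f : A → B) (xs : List A) → countᵇ g (map f xs) ≡ countᵇ (λ x → g (f x)) xs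
  countᵇ-map g f []       = refl
  countᵇ-map g f (x ∷ xs) = begin
    countᵇ g (f x ∷ map f xs)                      ≡⟨ countᵇ-∷ g (f x) _ ⟩
    ind (g (f x)) + countᵇ g (map f xs)            ≡⟨ cong (ind (g (f x)) +_) (countᵇ-map g f xs) ⟩
    ind (g (f x)) + countᵇ (λ x → g (f x)) xs      ≡⟨ countᵇ-∷ (λ x → g (f x)) x xs ⟨
    countᵇ (λ x → g (f x)) (x ∷ xs)                ∎
    where open ≡-Reasoning

sumTo : ℕ → (ℕ → ℕ) → ℕ
sumTo zero    f = 0
sumTo (suc K) f = f 0 + sumTo K (λ j → f (suc j))

module _ {B : Set} where

  countᵇ-concatMap-applyUpTo : (g : B → Bool) (F : ℕ → List B) (h : ℕ → ℕ) (K : ℕ) →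
    countᵇ g (concatMap F (applyUpTo h K)) ≡ sumTo K (λ j → countᵇ g (F (h j)))
  countᵇ-concatMap-applyUpTo g F h zero    = refl
  countᵇ-concatMap-applyUpTo g F h (suc K) =
    trans (countᵇ-++ g (F (h 0)) _) (cong (countᵇ g (F (h 0)) +_) (countᵇ-concatMap-applyUpTo g F (λ j → h (suc j)) K))

countᵇ-applyUpTo : (g : ℕ → Bool) (h : ℕ → ℕ) (K : ℕ) → countᵇ g (applyUpTo h K) ≡ sumTo K (λ j → ind (g (h j)))
countᵇ-applyUpTo g h zero    = refl
countᵇ-applyUpTo g h (suc K) = trans (countᵇ-∷ g (h 0) _) (cong (ind (g (h 0)) +_) (countᵇ-applyUpTo g (λ j → h (suc j)) K))

countᵇ-upTo : (g : ℕ → Bool) (K : ℕ) → countᵇ g (upTo K) ≡ sumTo K (λ j → ind (g j))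
countᵇ-upTo g = countᵇ-applyUpTo g (λ j → j)

sumTo-cong : (K : ℕ) {f g : ℕ → ℕ} → (∀ j → j < K → f j ≡ g j) → sumTo K f ≡ sumTo K g
sumTo-cong zero    _   = refl
sumTo-cong (suc K) f≗g = cong₂ _+_ (f≗g 0 z<s) (sumTo-cong K (λ j j<K → f≗g (suc j) (s<s j<K)))

sumTo-zero : (K : ℕ) {f : ℕ → ℕ} → (∀ j → j < K → f j ≡ 0) → sumTo K f ≡ 0
sumTo-zero zero    _  = refl
sumTo-zero (suc K) f0 = cong₂ _+_ (f0 0 z<s) (sumTo-zero K (λ j j<K → f0 (suc j) (s<s j<K)))

sumTo-+ : (a b : ℕ) (f : ℕ → ℕ) → sumTo (a + b) f ≡ sumTo a f + sumTo b (λ j → f (a + j))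
sumTo-+ zero    b f = refl
sumTo-+ (suc a) b f = trans (cong (f 0 +_) (sumTo-+ a b (λ j → f (suc j)))) (sym (+-assoc (f 0) _ _))

sumTo-suc : (K : ℕ) (f : ℕ → ℕ) → sumTo (suc K) f ≡ sumTo K f + f K
sumTo-suc zero    f = +-comm (f 0) 0
sumTo-suc (suc K) f = trans (cong (f 0 +_) (sumTo-suc K (λ j → f (suc j)))) (sym (+-assoc (f 0) _ _))

sumTo-distrib : (K : ℕ) (f g : ℕ → ℕ) → sumTo K (λ j → f j + g j) ≡ sumTo K f + sumTo K g
sumTo-distrib zero    f g = refl
sumTo-distrib (suc K) f g =
  trans (cong (f 0 + g 0 +_) (sumTo-distrib K _ _)) (interchange (f 0) (g 0) _ _)
  where
  interchange : ∀ a b c d → a + b + (c + d) ≡ a + c + (b + d)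
  interchange = solve-∀

sumTo-one : (K : ℕ) → sumTo K (λ _ → 1) ≡ K
sumTo-one zero    = refl
sumTo-one (suc K) = cong suc (sumTo-one K)

sumTo-reverse : (K : ℕ) (f : ℕ → ℕ) → sumTo K f ≡ sumTo K (λ u → f (K ∸ suc u))
sumTo-reverse zero    f = refl
sumTo-reverse (suc K) f = begin
  f 0 + sumTo K (λ j → f (suc j))                          ≡⟨ cong (f 0 +_) (sumTo-reverse K (λ j → f (suc j))) ⟩
  f 0 + sumTo K (λ u → f (suc (K ∸ suc u)))                ≡⟨ +-comm (f 0) _ ⟩
  sumTo K (λ u → f (suc (K ∸ suc u))) + f 0                ≡⟨ cong₂ _+_ (sumTo-cong K (λ u u<K → cong f (sym (+-∸-assoc 1 u<K))))
                                                                        (cong f (sym (n∸n≡0 K))) ⟩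
  sumTo K (λ u → f (suc K ∸ suc u)) + f (suc K ∸ suc K)    ≡⟨ sumTo-suc K _ ⟨
  sumTo (suc K) (λ u → f (suc K ∸ suc u))                  ∎
  where open ≡-Reasoning

sumTo-dropTail : (T K : ℕ) (f : ℕ → ℕ) → T ≤ K → (∀ j → T ≤ j → j < K → f j ≡ 0) → sumTo K f ≡ sumTo T f
sumTo-dropTail T K f T≤K tail0 = begin
  sumTo K f                                        ≡⟨ cong (λ z → sumTo z f) (m+[n∸m]≡n T≤K) ⟨
  sumTo (T + (K ∸ T)) f                            ≡⟨ sumTo-+ T (K ∸ T) f ⟩
  sumTo T f + sumTo (K ∸ T) (λ j → f (T + j))      ≡⟨ cong (sumTo T f +_) (sumTo-zero (K ∸ T) (λ j j< → tail0 (T + j) (m≤m+n T j) (T+j<K j j<))) ⟩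
  sumTo T f + 0                                    ≡⟨ +-identityʳ _ ⟩
  sumTo T f                                        ∎
  where
  open ≡-Reasoning
  T+j<K : ∀ j → j < K ∸ T → T + j < K
  T+j<K j j< = subst (T + j <_) (m+[n∸m]≡n T≤K) (+-monoʳ-< T j<)

sumTo-dropHead : (L K : ℕ) (f : ℕ → ℕ) → L ≤ K → (∀ j → j < L → f j ≡ 0) → sumTo K f ≡ sumTo (K ∸ L) (λ j → f (L + j))
sumTo-dropHead L K f L≤K head0 = begin
  sumTo K f                                        ≡⟨ cong (λ z → sumTo z f) (m+[n∸m]≡n L≤K) ⟨
  sumTo (L + (K ∸ L)) f                            ≡⟨ sumTo-+ L (K ∸ L) f ⟩
  sumTo L f + sumTo (K ∸ L) (λ j → f (L + j))      ≡⟨ cong (_+ sumTo (K ∸ L) (λ j → f (L + j))) (sumTo-zero L head0) ⟩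
  sumTo (K ∸ L) (λ j → f (L + j))                  ∎
  where open ≡-Reasoning

sumTo-single : (K c : ℕ) (f : ℕ → ℕ) → c < K → (∀ j → j < K → j ≢ c → f j ≡ 0) → sumTo K f ≡ f c
sumTo-single K c f c<K others0 = begin
  sumTo K f             ≡⟨ sumTo-dropTail (suc c) K f c<K (λ j c<j j<K → others0 j j<K (λ j≡c → <-irrefl (sym j≡c) c<j)) ⟩
  sumTo (suc c) f       ≡⟨ sumTo-suc c f ⟩
  sumTo c f + f c       ≡⟨ cong (_+ f c) (sumTo-zero c (λ j j<c → others0 j (<-trans j<c c<K) (λ j≡c → <-irrefl j≡c j<c))) ⟩
  f c                   ∎
  where open ≡-Reasoning

sumTo-indicator-interval : (K lo hi : ℕ) (f : ℕ → Bool) → hi ≤ K →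
  (∀ t → t < K → T (f t) → lo ≤ t × t < hi) → (∀ t → lo ≤ t → t < hi → T (f t)) →
  sumTo K (λ t → ind (f t)) ≡ hi ∸ lo
sumTo-indicator-interval K lo hi f hi≤K sound complete with lo ≤? hi
... | yes lo≤hi = begin
  sumTo K (λ t → ind (f t))                 ≡⟨ sumTo-dropTail hi K _ hi≤K (λ t hi≤t t<K → ind-false (λ ft → <⇒≱ (proj₂ (sound t t<K ft)) hi≤t)) ⟩
  sumTo hi (λ t → ind (f t))                ≡⟨ sumTo-dropHead lo hi _ lo≤hi (λ t t<lo → ind-false (λ ft → <⇒≱ t<lo (proj₁ (sound t (t<K t t<lo) ft)))) ⟩
  sumTo (hi ∸ lo) (λ j → ind (f (lo + j)))  ≡⟨ sumTo-cong (hi ∸ lo) (λ j j< → ind-true (complete (lo + j) (m≤m+n lo j) (subst (lo + j <_) (m+[n∸m]≡n lo≤hi) (+-monoʳ-< lo j<)))) ⟩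
  sumTo (hi ∸ lo) (λ _ → 1)                 ≡⟨ sumTo-one (hi ∸ lo) ⟩
  hi ∸ lo                                   ∎
  where
  open ≡-Reasoning
  t<K : ∀ t → t < lo → t < K
  t<K t t<lo = <-≤-trans t<lo (≤-trans lo≤hi hi≤K)
... | no lo≰hi = trans (sumTo-zero K (λ t t<K → ind-false (λ ft → let (lo≤t , t<hi) = sound t t<K ft in lo≰hi (≤-trans lo≤t (<⇒≤ t<hi)))))
                       (sym (m≤n⇒m∸n≡0 (<⇒≤ (≰⇒> lo≰hi))))

sumTo-triangle-transpose : (K : ℕ) (f : ℕ → ℕ → ℕ) →
  sumTo K (λ a → sumTo (K ∸ a) (λ b → f a b)) ≡ sumTo K (λ b → sumTo (K ∸ b) (λ a → f a b))
sumTo-triangle-transpose zero    f = refl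
sumTo-triangle-transpose (suc K) f = begin
  sumTo (suc K) (λ a → sumTo (suc K ∸ a) (λ b → f a b))                        ≡⟨ peel f ⟩
  sumTo K (λ a → sumTo (K ∸ a) (f a)) + sumTo (suc K) (λ a → f a (K ∸ a))      ≡⟨ cong₂ _+_ (sumTo-triangle-transpose K f) antidiagonal ⟩
  sumTo K (λ b → sumTo (K ∸ b) (λ a → f a b)) + sumTo (suc K) (λ b → f (K ∸ b) b) ≡⟨ peel (λ b a → f a b) ⟨
  sumTo (suc K) (λ b → sumTo (suc K ∸ b) (λ a → f a b))                        ∎
  where
  open ≡-Reasoning
  peel : (h : ℕ → ℕ → ℕ) →
    sumTo (suc K) (λ a → sumTo (suc K ∸ a) (h a)) ≡ sumTo K (λ a → sumTo (K ∸ a) (h a)) + sumTo (suc K) (λ a → h a (K ∸ a))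
  peel h = begin
    sumTo (suc K) (λ a → sumTo (suc K ∸ a) (h a))
      ≡⟨ sumTo-cong (suc K) (λ a a≤K → trans (cong (λ z → sumTo z (h a)) (+-∸-assoc 1 (≤-pred a≤K))) (sumTo-suc (K ∸ a) (h a))) ⟩
    sumTo (suc K) (λ a → sumTo (K ∸ a) (h a) + h a (K ∸ a))
      ≡⟨ sumTo-distrib (suc K) (λ a → sumTo (K ∸ a) (h a)) (λ a → h a (K ∸ a)) ⟩
    sumTo (suc K) (λ a → sumTo (K ∸ a) (h a)) + sumTo (suc K) (λ a → h a (K ∸ a))
      ≡⟨ cong (_+ sumTo (suc K) (λ a → h a (K ∸ a))) (trans (sumTo-suc K (λ a → sumTo (K ∸ a) (h a))) (cong (λ z → sumTo K (λ a → sumTo (K ∸ a) (h a)) + sumTo z (h K)) (n∸n≡0 K))) ⟩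
    sumTo K (λ a → sumTo (K ∸ a) (h a)) + 0 + sumTo (suc K) (λ a → h a (K ∸ a))
      ≡⟨ cong (_+ sumTo (suc K) (λ a → h a (K ∸ a))) (+-identityʳ (sumTo K (λ a → sumTo (K ∸ a) (h a)))) ⟩
    sumTo K (λ a → sumTo (K ∸ a) (h a)) + sumTo (suc K) (λ a → h a (K ∸ a)) ∎
  antidiagonal : sumTo (suc K) (λ a → f a (K ∸ a)) ≡ sumTo (suc K) (λ b → f (K ∸ b) b)
  antidiagonal = trans (sumTo-reverse (suc K) (λ a → f a (K ∸ a))) (sumTo-cong (suc K) (λ b b≤K → cong (f (K ∸ b)) (m∸[m∸n]≡n (≤-pred b≤K))))

sumTo-triangle-transpose+ : (M e : ℕ) → e ≤ 1 → (H : ℕ → ℕ → ℕ) →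
  sumTo (suc M) (λ y → sumTo ((M ∸ y) + e) (λ w → H w y)) ≡ sumTo (suc M) (λ s → sumTo ((M ∸ s) + e) (λ w → H s w))
sumTo-triangle-transpose+ M .0 z≤n H = begin
  sumTo (suc M) (λ y → sumTo ((M ∸ y) + 0) (λ w → H w y))   ≡⟨ sumTo-cong (suc M) (λ y _ → cong (λ z → sumTo z (λ w → H w y)) (+-identityʳ (M ∸ y))) ⟩
  sumTo (suc M) (λ y → sumTo (M ∸ y) (λ w → H w y))         ≡⟨ dropLast (λ y w → H w y) ⟩
  sumTo M (λ y → sumTo (M ∸ y) (λ w → H w y))               ≡⟨ sumTo-triangle-transpose M (λ y w → H w y) ⟩
  sumTo M (λ s → sumTo (M ∸ s) (λ w → H s w))               ≡⟨ dropLast H ⟨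
  sumTo (suc M) (λ s → sumTo (M ∸ s) (λ w → H s w))         ≡⟨ sumTo-cong (suc M) (λ s _ → cong (λ z → sumTo z (λ w → H s w)) (sym (+-identityʳ (M ∸ s)))) ⟩
  sumTo (suc M) (λ s → sumTo ((M ∸ s) + 0) (λ w → H s w))   ∎
  where
  open ≡-Reasoning
  dropLast : (h : ℕ → ℕ → ℕ) → sumTo (suc M) (λ y → sumTo (M ∸ y) (h y)) ≡ sumTo M (λ y → sumTo (M ∸ y) (h y))
  dropLast h = trans (sumTo-suc M (λ y → sumTo (M ∸ y) (h y))) (trans (cong (λ z → sumTo M (λ y → sumTo (M ∸ y) (h y)) + sumTo z (h M)) (n∸n≡0 M)) (+-identityʳ _))
sumTo-triangle-transpose+ M .1 (s≤s z≤n) H = begin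
  sumTo (suc M) (λ y → sumTo ((M ∸ y) + 1) (λ w → H w y))   ≡⟨ sumTo-cong (suc M) (λ y y≤M → cong (λ z → sumTo z (λ w → H w y)) (+1≡suc∸ y y≤M)) ⟩
  sumTo (suc M) (λ y → sumTo (suc M ∸ y) (λ w → H w y))     ≡⟨ sumTo-triangle-transpose (suc M) (λ y w → H w y) ⟩
  sumTo (suc M) (λ s → sumTo (suc M ∸ s) (λ w → H s w))     ≡⟨ sumTo-cong (suc M) (λ s s≤M → cong (λ z → sumTo z (λ w → H s w)) (sym (+1≡suc∸ s s≤M))) ⟩
  sumTo (suc M) (λ s → sumTo ((M ∸ s) + 1) (λ w → H s w))   ∎
  where
  open ≡-Reasoning
  +1≡suc∸ : ∀ y → y < suc M → (M ∸ y) + 1 ≡ suc M ∸ y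
  +1≡suc∸ y y≤M = trans (+-comm (M ∸ y) 1) (sym (+-∸-assoc 1 (≤-pred y≤M)))

-- Regroups the pairs v < y ≤ M by the gap s = y − v − 1.
sumTo-triangle-byGap : (M : ℕ) (G : ℕ → ℕ → ℕ) →
  sumTo (suc M) (λ y → sumTo y (λ v → G v y)) ≡ sumTo (suc M) (λ s → sumTo (M ∸ s) (λ w → G w (s + suc w)))
sumTo-triangle-byGap zero    G = refl
sumTo-triangle-byGap (suc M) G = begin
  sumTo (suc (suc M)) (λ y → sumTo y (λ v → G v y))
    ≡⟨ sumTo-suc (suc M) (λ y → sumTo y (λ v → G v y)) ⟩
  sumTo (suc M) (λ y → sumTo y (λ v → G v y)) + sumTo (suc M) (λ v → G v (suc M))
    ≡⟨ cong₂ _+_ (sumTo-triangle-byGap M G) (sumTo-reverse (suc M) (λ v → G v (suc M))) ⟩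
  sumTo (suc M) (λ s → sumTo (M ∸ s) (λ w → G w (s + suc w))) + sumTo (suc M) (λ s → G (M ∸ s) (suc M))
    ≡⟨ sumTo-distrib (suc M) (λ s → sumTo (M ∸ s) (λ w → G w (s + suc w))) (λ s → G (M ∸ s) (suc M)) ⟨
  sumTo (suc M) (λ s → sumTo (M ∸ s) (λ w → G w (s + suc w)) + G (M ∸ s) (suc M))
    ≡⟨ sumTo-cong (suc M) (λ s s≤M → sym (extend s (≤-pred s≤M))) ⟩
  sumTo (suc M) (λ s → sumTo (suc M ∸ s) (λ w → G w (s + suc w)))
    ≡⟨ trans (cong (sumTo (suc M) (λ s → sumTo (suc M ∸ s) (λ w → G w (s + suc w))) +_) lastEmpty) (+-identityʳ _) ⟨
  sumTo (suc M) (λ s → sumTo (suc M ∸ s) (λ w → G w (s + suc w))) + sumTo (suc M ∸ suc M) (λ w → G w (suc M + suc w))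
    ≡⟨ sumTo-suc (suc M) (λ s → sumTo (suc M ∸ s) (λ w → G w (s + suc w))) ⟨
  sumTo (suc (suc M)) (λ s → sumTo (suc M ∸ s) (λ w → G w (s + suc w))) ∎
  where
  open ≡-Reasoning
  extend : ∀ s → s ≤ M → sumTo (suc M ∸ s) (λ w → G w (s + suc w)) ≡ sumTo (M ∸ s) (λ w → G w (s + suc w)) + G (M ∸ s) (suc M)
  extend s s≤M = begin
    sumTo (suc M ∸ s) (λ w → G w (s + suc w))                           ≡⟨ cong (λ z → sumTo z (λ w → G w (s + suc w))) (+-∸-assoc 1 s≤M) ⟩
    sumTo (suc (M ∸ s)) (λ w → G w (s + suc w))                         ≡⟨ sumTo-suc (M ∸ s) _ ⟩
    sumTo (M ∸ s) (λ w → G w (s + suc w)) + G (M ∸ s) (s + suc (M ∸ s)) ≡⟨ cong (λ z → sumTo (M ∸ s) (λ w → G w (s + suc w)) + G (M ∸ s) z)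
                                                                                (trans (+-suc s (M ∸ s)) (cong suc (m+[n∸m]≡n s≤M))) ⟩
    sumTo (M ∸ s) (λ w → G w (s + suc w)) + G (M ∸ s) (suc M)           ∎
  lastEmpty : sumTo (suc M ∸ suc M) (λ w → G w (suc M + suc w)) ≡ 0
  lastEmpty = cong (λ z → sumTo z (λ w → G w (suc M + suc w))) (n∸n≡0 (suc M))

sumTo-double : (L : ℕ) (h : ℕ → ℕ) → sumTo (L + L) h ≡ sumTo L (λ w → h (suc (w + w))) + sumTo L (λ w → h (w + w))
sumTo-double zero    h = refl
sumTo-double (suc L) h = begin
  sumTo (suc (L + suc L)) h
    ≡⟨ cong (λ z → sumTo (suc z) h) (+-suc L L) ⟩
  h 0 + (h 1 + sumTo (L + L) (λ j → h (suc (suc j))))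
    ≡⟨ cong (λ z → h 0 + (h 1 + z)) (sumTo-double L (λ j → h (suc (suc j)))) ⟩
  h 0 + (h 1 + (sumTo L (λ w → h (suc (suc (suc (w + w))))) + sumTo L (λ w → h (suc (suc (w + w))))))
    ≡⟨ regroup (h 0) (h 1) _ _ ⟩
  (h 1 + sumTo L (λ w → h (suc (suc (suc (w + w)))))) + (h 0 + sumTo L (λ w → h (suc (suc (w + w)))))
    ≡⟨ cong₂ (λ a b → (h 1 + a) + (h 0 + b)) (sumTo-cong L (λ w _ → cong (λ z → h (suc (suc z))) (sym (+-suc w w))))
                                              (sumTo-cong L (λ w _ → cong (λ z → h (suc z)) (sym (+-suc w w)))) ⟩
  sumTo (suc L) (λ w → h (suc (w + w))) + sumTo (suc L) (λ w → h (w + w)) ∎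
  where
  open ≡-Reasoning
  regroup : ∀ a b c d → a + (b + (c + d)) ≡ (b + c) + (a + d)
  regroup = solve-∀

sumTo-oddEven : (L e : ℕ) → e ≤ 1 → (h : ℕ → ℕ) →
  sumTo (L + L + e) h ≡ sumTo L (λ w → h (suc (w + w))) + sumTo (L + e) (λ w → h (w + w))
sumTo-oddEven L .0 z≤n h = begin
  sumTo (L + L + 0) h                                                        ≡⟨ cong (λ z → sumTo z h) (+-identityʳ (L + L)) ⟩
  sumTo (L + L) h                                                            ≡⟨ sumTo-double L h ⟩
  sumTo L (λ w → h (suc (w + w))) + sumTo L (λ w → h (w + w))                ≡⟨ cong (λ z → sumTo L (λ w → h (suc (w + w))) + sumTo z (λ w → h (w + w))) (+-identityʳ L) ⟨
  sumTo L (λ w → h (suc (w + w))) + sumTo (L + 0) (λ w → h (w + w))          ∎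
  where open ≡-Reasoning
sumTo-oddEven L .1 (s≤s z≤n) h = begin
  sumTo (L + L + 1) h                                                        ≡⟨ sumTo-+ (L + L) 1 h ⟩
  sumTo (L + L) h + (h (L + L + 0) + 0)                                      ≡⟨ cong (_+ (h (L + L + 0) + 0)) (sumTo-double L h) ⟩
  sumTo L (λ w → h (suc (w + w))) + sumTo L (λ w → h (w + w)) + (h (L + L + 0) + 0)
                                                                             ≡⟨ +-assoc (sumTo L (λ w → h (suc (w + w)))) _ _ ⟩
  sumTo L (λ w → h (suc (w + w))) + (sumTo L (λ w → h (w + w)) + (h (L + L + 0) + 0))
                                                                             ≡⟨ cong (λ z → sumTo L (λ w → h (suc (w + w))) + (sumTo L (λ w → h (w + w)) + (h z + 0))) (double+0 L) ⟩
  sumTo L (λ w → h (suc (w + w))) + (sumTo L (λ w → h (w + w)) + (h ((L + 0) + (L + 0)) + 0))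
                                                                             ≡⟨ cong (sumTo L (λ w → h (suc (w + w))) +_) (sumTo-+ L 1 (λ w → h (w + w))) ⟨
  sumTo L (λ w → h (suc (w + w))) + sumTo (L + 1) (λ w → h (w + w))          ∎
  where
  open ≡-Reasoning
  double+0 : ∀ L → L + L + 0 ≡ (L + 0) + (L + 0)
  double+0 = solve-∀

countᵇ-words-noEast : (R : List Step → Bool) (k : ℕ) →
  countᵇ (λ w → (countE w ≡ᵇ 0) ∧ R w) (words k) ≡ ind (R (replicate k N))
countᵇ-words-noEast R zero    = trans (countᵇ-∷ (λ w → (countE w ≡ᵇ 0) ∧ R w) [] []) (+-identityʳ _)
countᵇ-words-noEast R (suc k) = begin
  countᵇ P (map (N ∷_) (words k) ++ map (E ∷_) (words k))                     ≡⟨ countᵇ-++ P (map (N ∷_) (words k)) (map (E ∷_) (words k)) ⟩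
  countᵇ P (map (N ∷_) (words k)) + countᵇ P (map (E ∷_) (words k))           ≡⟨ cong₂ _+_ (countᵇ-map P (N ∷_) (words k)) (countᵇ-map P (E ∷_) (words k)) ⟩
  countᵇ (λ w → P (N ∷ w)) (words k) + countᵇ (λ w → P (E ∷ w)) (words k)     ≡⟨ cong₂ _+_ (countᵇ-words-noEast (λ w → R (N ∷ w)) k) (noneTrue (words k)) ⟩
  ind (R (replicate (suc k) N)) + 0                                           ≡⟨ +-identityʳ _ ⟩
  ind (R (replicate (suc k) N))                                               ∎
  where
  open ≡-Reasoning
  P : List Step → Bool
  P = λ w → (countE w ≡ᵇ 0) ∧ R w
  noneTrue : (ws : List (List Step)) → countᵇ (λ _ → false) ws ≡ 0
  noneTrue []       = refl
  noneTrue (_ ∷ ws) = noneTrue ws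

countᵇ-words-sucEast : (c : ℕ) (R : List Step → Bool) (k : ℕ) →
  countᵇ (λ w → (countE w ≡ᵇ suc c) ∧ R w) (words k) ≡
  sumTo k (λ j → countᵇ (λ w → (countE w ≡ᵇ c) ∧ R (replicate j N ++ E ∷ w)) (words (k ∸ suc j)))
countᵇ-words-sucEast c R zero    = refl
countᵇ-words-sucEast c R (suc k) = begin
  countᵇ P (map (N ∷_) (words k) ++ map (E ∷_) (words k))                     ≡⟨ countᵇ-++ P (map (N ∷_) (words k)) (map (E ∷_) (words k)) ⟩
  countᵇ P (map (N ∷_) (words k)) + countᵇ P (map (E ∷_) (words k))           ≡⟨ cong₂ _+_ (countᵇ-map P (N ∷_) (words k)) (countᵇ-map P (E ∷_) (words k)) ⟩
  countᵇ (λ w → P (N ∷ w)) (words k) + countᵇ (λ w → P (E ∷ w)) (words k)     ≡⟨ cong (_+ countᵇ (λ w → P (E ∷ w)) (words k)) (countᵇ-words-sucEast c (λ w → R (N ∷ w)) k) ⟩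
  Later + countᵇ (λ w → P (E ∷ w)) (words k)                                  ≡⟨ +-comm Later _ ⟩
  sumTo (suc k) (λ j → countᵇ (λ w → (countE w ≡ᵇ c) ∧ R (replicate j N ++ E ∷ w)) (words (suc k ∸ suc j))) ∎
  where
  open ≡-Reasoning
  P : List Step → Bool
  P = λ w → (countE w ≡ᵇ suc c) ∧ R w
  Later : ℕ
  Later = sumTo k (λ j → countᵇ (λ w → (countE w ≡ᵇ c) ∧ R (N ∷ (replicate j N ++ E ∷ w))) (words (k ∸ suc j)))

countN-replicate : (j : ℕ) (w : List Step) → countN (replicate j N ++ w) ≡ j + countN w
countN-replicate zero    w = refl
countN-replicate (suc j) w = cong suc (countN-replicate j w)

eastHeights-replicate : (j k : ℕ) (w : List Step) → eastHeights k (replicate j N ++ w) ≡ eastHeights (j + k) w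
eastHeights-replicate zero    k w = refl
eastHeights-replicate (suc j) k w = trans (eastHeights-replicate j (suc k) w) (cong (λ z → eastHeights z w) (+-suc j k))

aboveFrom-head : (n e k : ℕ) (w : List Step) → T (aboveFrom n e k w) → n * e ≤ 3 * k
aboveFrom-head n e k []      t = ≤ᵇ⇒≤ _ _ t
aboveFrom-head n e k (N ∷ w) t = ≤ᵇ⇒≤ _ _ (∧-l t)
aboveFrom-head n e k (E ∷ w) t = ≤ᵇ⇒≤ _ _ (∧-l t)

aboveFrom-replicate⁻ : (n e j k : ℕ) (w : List Step) → T (aboveFrom n e k (replicate j N ++ w)) → T (aboveFrom n e (j + k) w)
aboveFrom-replicate⁻ n e zero    k w t = t
aboveFrom-replicate⁻ n e (suc j) k w t =
  subst (λ z → T (aboveFrom n e z w)) (+-suc j k) (aboveFrom-replicate⁻ n e j (suc k) w (∧-r t))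

aboveFrom-replicate⁺ : (n e j k : ℕ) (w : List Step) → n * e ≤ 3 * k → T (aboveFrom n e (j + k) w) → T (aboveFrom n e k (replicate j N ++ w))
aboveFrom-replicate⁺ n e zero    k w _   t = t
aboveFrom-replicate⁺ n e (suc j) k w n*e≤ t =
  ∧-intro (≤⇒≤ᵇ n*e≤) (aboveFrom-replicate⁺ n e j (suc k) w (≤-trans n*e≤ (*-monoʳ-≤ 3 (n≤1+n k)))
                         (subst (λ z → T (aboveFrom n e z w)) (sym (+-suc j k)) t))

-- The statistics of a path depend only on its list of east-step heights.

inLambdaH : List ℕ → ℕ → ℕ → Bool
inLambdaH hs a b = nth hs (a ∸ 1) <ᵇ b

armH : List ℕ → ℕ → ℕ → ℕ
armH hs a b = countᵇ (λ a' → (a <ᵇ a') ∧ inLambdaH hs a' b) (range1 3)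

legH : ℕ → List ℕ → ℕ → ℕ → ℕ
legH n hs a b = countᵇ (λ b' → (b' <ᵇ b) ∧ inLambdaH hs a b') (range1 n)

dinvCondition : ℕ → Bool → ℕ → ℕ → Bool
dinvCondition n inλ arm leg = inλ ∧ ((n * arm) <ᵇ (3 * (leg + 1))) ∧ ((3 * leg) <ᵇ (n * (arm + 1)))

dinvCellH : ℕ → List ℕ → ℕ × ℕ → Bool
dinvCellH n hs (a , b) = dinvCondition n (inLambdaH hs a b) (armH hs a b) (legH n hs a b)

dinvH : ℕ → List ℕ → ℕ
dinvH n hs = countᵇ (dinvCellH n hs) (cells n)

areaCellH : ℕ → List ℕ → ℕ × ℕ → Bool
areaCellH n hs (a , b) = not (inLambdaH hs a b) ∧ (n * a ≤ᵇ 3 * (b ∸ 1))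

areaH : ℕ → List ℕ → ℕ
areaH n hs = countᵇ (areaCellH n hs) (cells n)

dinv≡dinvH : (n : ℕ) (p : List Step) → dinv n p ≡ dinvH n (eastHeights 0 p)
dinv≡dinvH n p = countᵇ-cong (cells n) (λ { (a , b) → refl })

area≡areaH : (n : ℕ) (p : List Step) → area n p ≡ areaH n (eastHeights 0 p)
area≡areaH n p = countᵇ-cong (cells n) (λ { (a , b) → refl })

threeEastWord : ℕ → ℕ → ℕ → ℕ → List Step
threeEastWord j₁ j₂ j₃ r = replicate j₁ N ++ E ∷ (replicate j₂ N ++ E ∷ (replicate j₃ N ++ E ∷ replicate r N))

counted : ℕ → (ℕ × ℕ → Bool) → List Step → Bool
counted n g p = ((countN p ≡ᵇ n) ∧ aboveFrom n 0 0 p) ∧ g (dinv n p , area n p)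

countᵇ-catalan3-words : (n : ℕ) (g : ℕ × ℕ → Bool) → countᵇ g (catalan3 n) ≡
  sumTo (n + 3) (λ j₁ → sumTo (n + 3 ∸ suc j₁) (λ j₂ → sumTo ((n + 3 ∸ suc j₁) ∸ suc j₂) (λ j₃ →
    ind (counted n g (threeEastWord j₁ j₂ j₃ (((n + 3 ∸ suc j₁) ∸ suc j₂) ∸ suc j₃))))))
countᵇ-catalan3-words n g = begin
  countᵇ g (map stats (filterᵇ (isDyck n) (words (n + 3))))
    ≡⟨ countᵇ-map g stats (filterᵇ (isDyck n) (words (n + 3))) ⟩
  countᵇ (λ p → g (stats p)) (filterᵇ (isDyck n) (words (n + 3)))
    ≡⟨ countᵇ-filterᵇ (isDyck n) (λ p → g (stats p)) (words (n + 3)) ⟩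
  countᵇ (λ p → isDyck n p ∧ g (stats p)) (words (n + 3))
    ≡⟨ countᵇ-cong (words (n + 3)) (λ p → ∧-assoc (countE p ≡ᵇ 3) ((countN p ≡ᵇ n) ∧ aboveFrom n 0 0 p) (g (stats p))) ⟩
  countᵇ (λ p → (countE p ≡ᵇ 3) ∧ counted n g p) (words (n + 3))
    ≡⟨ countᵇ-words-sucEast 2 (counted n g) (n + 3) ⟩
  sumTo (n + 3) (λ j₁ → countᵇ (λ w → (countE w ≡ᵇ 2) ∧ counted n g (replicate j₁ N ++ E ∷ w)) (words (n + 3 ∸ suc j₁)))
    ≡⟨ sumTo-cong (n + 3) (λ j₁ _ → trans (countᵇ-words-sucEast 1 _ (n + 3 ∸ suc j₁))
         (sumTo-cong (n + 3 ∸ suc j₁) (λ j₂ _ → trans (countᵇ-words-sucEast 0 _ ((n + 3 ∸ suc j₁) ∸ suc j₂))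
           (sumTo-cong ((n + 3 ∸ suc j₁) ∸ suc j₂) (λ j₃ _ → countᵇ-words-noEast _ (((n + 3 ∸ suc j₁) ∸ suc j₂) ∸ suc j₃)))))) ⟩
  sumTo (n + 3) (λ j₁ → sumTo (n + 3 ∸ suc j₁) (λ j₂ → sumTo ((n + 3 ∸ suc j₁) ∸ suc j₂) (λ j₃ →
    ind (counted n g (threeEastWord j₁ j₂ j₃ (((n + 3 ∸ suc j₁) ∸ suc j₂) ∸ suc j₃)))))) ∎
  where
  open ≡-Reasoning
  stats : List Step → ℕ × ℕ
  stats = λ p → (dinv n p , area n p)

-- Only h₁ and h₂ = h₁ + x are free: the condition at the third east step, 3n ≤ 3h₃ ≤ 3n, forces h₃ = n.
heightsCounted : ℕ → (ℕ × ℕ → Bool) → ℕ → ℕ → Bool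
heightsCounted n g h₁ x =
  ((n ≤ᵇ 3 * h₁) ∧ (n * 2 ≤ᵇ 3 * (h₁ + x))) ∧ g (dinvH n (h₁ ∷ h₁ + x ∷ n ∷ []) , areaH n (h₁ ∷ h₁ + x ∷ n ∷ []))

private
  remainingNorth : (n j₁ j₂ : ℕ) → j₁ < n + 3 → j₂ < n + 3 ∸ suc j₁ → j₁ + j₂ + ((n + 3 ∸ suc j₁) ∸ suc j₂) ≡ suc n
  remainingNorth n j₁ j₂ j₁< j₂< = suc-injective (suc-injective (begin
    suc (suc (j₁ + j₂ + M))  ≡⟨ shuffle j₁ j₂ M ⟩
    suc j₁ + (suc j₂ + M)    ≡⟨ cong (suc j₁ +_) (m+[n∸m]≡n j₂<) ⟩
    suc j₁ + (n + 3 ∸ suc j₁) ≡⟨ m+[n∸m]≡n j₁< ⟩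
    n + 3                    ≡⟨ +-comm n 3 ⟩
    suc (suc (suc n))        ∎))
    where
    open ≡-Reasoning
    M : ℕ
    M = (n + 3 ∸ suc j₁) ∸ suc j₂
    shuffle : ∀ a b c → suc (suc (a + b + c)) ≡ suc a + (suc b + c)
    shuffle = solve-∀

  *3-cancel : (n k : ℕ) → n * 3 ≤ 3 * k → n ≤ k
  *3-cancel n k h = *-cancelˡ-≤ 3 (subst (_≤ 3 * k) (*-comm n 3) h)

module AboveAtEastSteps (n j₁ j₂ j₃ r : ℕ) (above : T (aboveFrom n 0 0 (threeEastWord j₁ j₂ j₃ r))) where
  private
    tail₂ : List Step
    tail₂ = replicate j₃ N ++ E ∷ replicate r N
    tail₁ : List Step
    tail₁ = replicate j₂ N ++ E ∷ tail₂
    k₁ k₂ k₃ : ℕ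
    k₁ = j₁ + 0
    k₂ = j₂ + k₁
    k₃ = j₃ + k₂
    afterFirst : T (aboveFrom n 1 k₁ tail₁)
    afterFirst = ∧-r (aboveFrom-replicate⁻ n 0 j₁ 0 (E ∷ tail₁) above)
    afterSecond : T (aboveFrom n 2 k₂ tail₂)
    afterSecond = ∧-r (aboveFrom-replicate⁻ n 1 j₂ k₁ (E ∷ tail₂) afterFirst)

  first : n * 1 ≤ 3 * k₁
  first = aboveFrom-head n 1 k₁ tail₁ afterFirst

  second : n * 2 ≤ 3 * k₂
  second = aboveFrom-head n 2 k₂ tail₂ afterSecond

  third : n * 3 ≤ 3 * k₃
  third = aboveFrom-head n 3 k₃ (replicate r N) (∧-r (aboveFrom-replicate⁻ n 2 j₃ k₂ (E ∷ replicate r N) afterSecond))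

aboveFrom-threeEastWord⁺ : (n j₁ j₂ j₃ : ℕ) → let k₁ = j₁ + 0 ; k₂ = j₂ + k₁ ; k₃ = j₃ + k₂ in
  n * 1 ≤ 3 * k₁ → n * 2 ≤ 3 * k₂ → n * 3 ≤ 3 * k₃ → T (aboveFrom n 0 0 (threeEastWord j₁ j₂ j₃ 0))
aboveFrom-threeEastWord⁺ n j₁ j₂ j₃ h₁ h₂ h₃ =
  aboveFrom-replicate⁺ n 0 j₁ 0 _ (≤-reflexive (*-zeroʳ n))
    (∧-intro (≤⇒≤ᵇ (subst (_≤ 3 * (j₁ + 0)) (sym (*-zeroʳ n)) z≤n))
      (aboveFrom-replicate⁺ n 1 j₂ (j₁ + 0) _ h₁
        (∧-intro (≤⇒≤ᵇ (≤-trans h₁ (*-monoʳ-≤ 3 (m≤n+m (j₁ + 0) j₂))))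
          (aboveFrom-replicate⁺ n 2 j₃ (j₂ + (j₁ + 0)) _ h₂
            (∧-intro (≤⇒≤ᵇ (≤-trans h₂ (*-monoʳ-≤ 3 (m≤n+m (j₂ + (j₁ + 0)) j₃)))) (≤⇒≤ᵇ h₃))))))

eastHeights-threeEastWord : (j₁ j₂ j₃ : ℕ) →
  eastHeights 0 (threeEastWord j₁ j₂ j₃ 0) ≡ (j₁ + 0) ∷ (j₂ + (j₁ + 0)) ∷ (j₃ + (j₂ + (j₁ + 0))) ∷ []
eastHeights-threeEastWord j₁ j₂ j₃ =
  trans (eastHeights-replicate j₁ 0 _) (cong ((j₁ + 0) ∷_)
    (trans (eastHeights-replicate j₂ (j₁ + 0) _) (cong ((j₂ + (j₁ + 0)) ∷_) (eastHeights-replicate j₃ (j₂ + (j₁ + 0)) (E ∷ [])))))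

private
  heights₃ : ∀ a b c → c + (b + (a + 0)) ≡ a + b + c
  heights₃ = solve-∀
  northCount : ∀ a b c → a + (b + (c + 0)) ≡ a + b + c
  northCount = solve-∀
  heights₂ : ∀ a b → b + (a + 0) ≡ a + b
  heights₂ = solve-∀

counted-threeEastWord : (n : ℕ) (g : ℕ × ℕ → Bool) (j₁ j₂ j₃ : ℕ) → j₁ + j₂ + j₃ ≡ n →
  counted n g (threeEastWord j₁ j₂ j₃ 0) ≡ heightsCounted n g j₁ j₂
counted-threeEastWord n g j₁ j₂ j₃ total =
  cong₂ _∧_ (bool-ext to from) (cong g (cong₂ _,_ (trans (dinv≡dinvH n p) (cong (dinvH n) hs)) (trans (area≡areaH n p) (cong (areaH n) hs))))
  where
  p : List Step
  p = threeEastWord j₁ j₂ j₃ 0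
  hs : eastHeights 0 p ≡ j₁ ∷ j₁ + j₂ ∷ n ∷ []
  hs = trans (eastHeights-threeEastWord j₁ j₂ j₃)
             (cong₂ _∷_ (+-identityʳ j₁) (cong₂ _∷_ (heights₂ j₁ j₂) (cong (_∷ []) (trans (heights₃ j₁ j₂ j₃) total))))
  north : countN p ≡ n
  north = trans (countN-replicate j₁ _)
                (trans (cong (j₁ +_) (trans (countN-replicate j₂ _) (cong (j₂ +_) (countN-replicate j₃ (E ∷ [])))))
                       (trans (northCount j₁ j₂ j₃) total))
  to : T ((countN p ≡ᵇ n) ∧ aboveFrom n 0 0 p) → T ((n ≤ᵇ 3 * j₁) ∧ (n * 2 ≤ᵇ 3 * (j₁ + j₂)))
  to t = ∧-intro (≤⇒≤ᵇ (subst₂ (λ a b → a ≤ 3 * b) (*-identityʳ n) (+-identityʳ j₁) (AboveAtEastSteps.first n j₁ j₂ j₃ 0 (∧-r t))))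
                 (≤⇒≤ᵇ (subst (λ b → n * 2 ≤ 3 * b) (heights₂ j₁ j₂) (AboveAtEastSteps.second n j₁ j₂ j₃ 0 (∧-r t))))
  from : T ((n ≤ᵇ 3 * j₁) ∧ (n * 2 ≤ᵇ 3 * (j₁ + j₂))) → T ((countN p ≡ᵇ n) ∧ aboveFrom n 0 0 p)
  from t = ∧-intro (≡⇒≡ᵇ _ _ north)
    (aboveFrom-threeEastWord⁺ n j₁ j₂ j₃
      (subst₂ (λ a b → a ≤ 3 * b) (sym (*-identityʳ n)) (sym (+-identityʳ j₁)) (≤ᵇ⇒≤ _ _ (∧-l t)))
      (subst (λ b → n * 2 ≤ 3 * b) (sym (heights₂ j₁ j₂)) (≤ᵇ⇒≤ _ _ (∧-r t)))
      (≤-reflexive (trans (*-comm n 3) (cong (3 *_) (sym (trans (heights₃ j₁ j₂ j₃) total))))))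

private
  thirdEastSum : (n : ℕ) (g : ℕ × ℕ → Bool) (j₁ j₂ : ℕ) → ℕ
  thirdEastSum n g j₁ j₂ =
    sumTo ((n + 3 ∸ suc j₁) ∸ suc j₂) (λ j₃ → ind (counted n g (threeEastWord j₁ j₂ j₃ (((n + 3 ∸ suc j₁) ∸ suc j₂) ∸ suc j₃))))

  thirdEastSum-within : (n : ℕ) (g : ℕ × ℕ → Bool) (j₁ j₂ : ℕ) → j₁ < n + 3 → j₂ < n + 3 ∸ suc j₁ → j₁ + j₂ ≤ n →
    thirdEastSum n g j₁ j₂ ≡ ind (heightsCounted n g j₁ j₂)
  thirdEastSum-within n g j₁ j₂ j₁< j₂< j₁+j₂≤n = begin
    sumTo M f                                 ≡⟨ sumTo-single M c f c<M othersFail ⟩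
    f c                                       ≡⟨ cong (λ z → ind (counted n g (threeEastWord j₁ j₂ c z))) (trans (cong (_∸ suc c) M≡) (n∸n≡0 c)) ⟩
    ind (counted n g (threeEastWord j₁ j₂ c 0)) ≡⟨ cong ind (counted-threeEastWord n g j₁ j₂ c total) ⟩
    ind (heightsCounted n g j₁ j₂)            ∎
    where
    open ≡-Reasoning
    M : ℕ
    M = (n + 3 ∸ suc j₁) ∸ suc j₂
    f : ℕ → ℕ
    f = λ j₃ → ind (counted n g (threeEastWord j₁ j₂ j₃ (M ∸ suc j₃)))
    c : ℕ
    c = n ∸ (j₁ + j₂)
    total : j₁ + j₂ + c ≡ n
    total = m+[n∸m]≡n j₁+j₂≤n
    M≡ : M ≡ suc c
    M≡ = +-cancelˡ-≡ (j₁ + j₂) M (suc c) (trans (remainingNorth n j₁ j₂ j₁< j₂<) (trans (cong suc (sym total)) (sym (+-suc (j₁ + j₂) c))))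
    c<M : c < M
    c<M = subst (c <_) (sym M≡) (n<1+n c)
    othersFail : ∀ j₃ → j₃ < M → j₃ ≢ c → f j₃ ≡ 0
    othersFail j₃ j₃<M j₃≢c = ind-false λ t →
      <⇒≱ k₃<n (*3-cancel n (j₃ + (j₂ + (j₁ + 0))) (AboveAtEastSteps.third n j₁ j₂ j₃ (M ∸ suc j₃) (∧-r {countN (threeEastWord j₁ j₂ j₃ (M ∸ suc j₃)) ≡ᵇ n} (∧-l t))))
      where
      j₃<c : j₃ < c
      j₃<c = ≤∧≢⇒< (≤-pred (subst (j₃ <_) M≡ j₃<M)) j₃≢c
      k₃<n : j₃ + (j₂ + (j₁ + 0)) < n
      k₃<n = subst₂ _<_ (sym (heights₃ j₁ j₂ j₃)) total (+-monoʳ-< (j₁ + j₂) j₃<c)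

  thirdEastSum-beyond : (n : ℕ) (g : ℕ × ℕ → Bool) (j₁ j₂ : ℕ) → j₁ < n + 3 → j₂ < n + 3 ∸ suc j₁ → n < j₁ + j₂ →
    thirdEastSum n g j₁ j₂ ≡ 0
  thirdEastSum-beyond n g j₁ j₂ j₁< j₂< n<j₁+j₂ = sumTo-zero M (λ j₃ j₃<M → ⊥-elim (n≮0 (subst (j₃ <_) M≡0 j₃<M)))
    where
    M : ℕ
    M = (n + 3 ∸ suc j₁) ∸ suc j₂
    M≡0 : M ≡ 0
    M≡0 = n≤0⇒n≡0 (+-cancelˡ-≤ (j₁ + j₂) M 0 (subst₂ _≤_ (sym (remainingNorth n j₁ j₂ j₁< j₂<)) (sym (+-identityʳ (j₁ + j₂))) n<j₁+j₂))

countᵇ-catalan3-heights : (n : ℕ) (g : ℕ × ℕ → Bool) →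
  countᵇ g (catalan3 n) ≡ sumTo (suc n) (λ h₁ → sumTo (suc n ∸ h₁) (λ x → ind (heightsCounted n g h₁ x)))
countᵇ-catalan3-heights n g = begin
  countᵇ g (catalan3 n)   ≡⟨ countᵇ-catalan3-words n g ⟩
  sumTo (n + 3) F         ≡⟨ sumTo-dropTail (suc n) (n + 3) F (subst (suc n ≤_) (sym n+3≡) (≤-trans (n≤1+n (suc n)) (n≤1+n _))) firstTooHigh ⟩
  sumTo (suc n) F         ≡⟨ sumTo-cong (suc n) secondSum ⟩
  sumTo (suc n) (λ h₁ → sumTo (suc n ∸ h₁) (λ x → ind (heightsCounted n g h₁ x))) ∎
  where
  open ≡-Reasoning
  n+3≡ : n + 3 ≡ suc (suc (suc n))
  n+3≡ = +-comm n 3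
  F : ℕ → ℕ
  F j₁ = sumTo (n + 3 ∸ suc j₁) (thirdEastSum n g j₁)
  firstTooHigh : ∀ j₁ → suc n ≤ j₁ → j₁ < n + 3 → F j₁ ≡ 0
  firstTooHigh j₁ n<j₁ j₁< = sumTo-zero (n + 3 ∸ suc j₁) (λ j₂ j₂< → thirdEastSum-beyond n g j₁ j₂ j₁< j₂< (<-≤-trans n<j₁ (m≤m+n j₁ j₂)))
  secondSum : ∀ j₁ → j₁ < suc n → F j₁ ≡ sumTo (suc n ∸ j₁) (λ x → ind (heightsCounted n g j₁ x))
  secondSum j₁ j₁≤n = trans (sumTo-dropTail (suc n ∸ j₁) (n + 3 ∸ suc j₁) (thirdEastSum n g j₁) bound tooHigh) (sumTo-cong (suc n ∸ j₁) within)
    where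
    j₁<n+3 : j₁ < n + 3
    j₁<n+3 = subst (j₁ <_) (sym n+3≡) (≤-trans j₁≤n (≤-trans (n≤1+n (suc n)) (n≤1+n _)))
    bound : suc n ∸ j₁ ≤ n + 3 ∸ suc j₁
    bound = subst (suc n ∸ j₁ ≤_) (sym (cong (_∸ suc j₁) n+3≡)) (∸-monoˡ-≤ j₁ (n≤1+n (suc n)))
    j₁+rest : j₁ + (suc n ∸ j₁) ≡ suc n
    j₁+rest = m+[n∸m]≡n (<⇒≤ j₁≤n)
    tooHigh : ∀ j₂ → suc n ∸ j₁ ≤ j₂ → j₂ < n + 3 ∸ suc j₁ → thirdEastSum n g j₁ j₂ ≡ 0
    tooHigh j₂ le j₂< = thirdEastSum-beyond n g j₁ j₂ j₁<n+3 j₂< (subst (_≤ j₁ + j₂) j₁+rest (+-monoʳ-≤ j₁ le))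
    within : ∀ j₂ → j₂ < suc n ∸ j₁ → thirdEastSum n g j₁ j₂ ≡ ind (heightsCounted n g j₁ j₂)
    within j₂ j₂< = thirdEastSum-within n g j₁ j₂ j₁<n+3 (<-≤-trans j₂< bound) (≤-pred (subst (j₁ + j₂ <_) j₁+rest (+-monoʳ-< j₁ j₂<)))

-- dinv and area of the path with east-step heights h₁ ≤ h₁ + x ≤ n

countᵇ-range1-3 : (P : ℕ → Bool) → countᵇ P (range1 3) ≡ ind (P 1) + (ind (P 2) + (ind (P 3) + 0))
countᵇ-range1-3 P = trans (countᵇ-∷ P 1 _) (cong (ind (P 1) +_) (trans (countᵇ-∷ P 2 _) (cong (ind (P 2) +_) (countᵇ-∷ P 3 []))))

countᵇ-column : (n a : ℕ) (f : ℕ × ℕ → Bool) → countᵇ f (map (λ b → (a , b)) (range1 n)) ≡ sumTo n (λ l → ind (f (a , suc l)))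
countᵇ-column n a f =
  trans (countᵇ-map f (λ b → (a , b)) (range1 n)) (trans (countᵇ-map (λ b → f (a , b)) suc (upTo n)) (countᵇ-upTo (λ l → f (a , suc l)) n))

countᵇ-cells : (n : ℕ) (f : ℕ × ℕ → Bool) → countᵇ f (cells n) ≡
  sumTo n (λ l → ind (f (1 , suc l))) + (sumTo n (λ l → ind (f (2 , suc l))) + (sumTo n (λ l → ind (f (3 , suc l))) + 0))
countᵇ-cells n f =
  trans (countᵇ-++ f (column 1) _) (cong₂ _+_ (countᵇ-column n 1 f)
    (trans (countᵇ-++ f (column 2) _) (cong₂ _+_ (countᵇ-column n 2 f) (trans (countᵇ-++ f (column 3) []) (cong (_+ 0) (countᵇ-column n 3 f))))))
  where column = λ a → map (λ b → (a , b)) (range1 n)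

<ᵇ-suc-+ : (h u : ℕ) → (h <ᵇ suc (h + u)) ≡ true
<ᵇ-suc-+ h u = T⇒≡true (<⇒<ᵇ (s≤s (m≤m+n h u)))

≥⇒<ᵇ-false : (a b : ℕ) → b ≤ a → (a <ᵇ b) ≡ false
≥⇒<ᵇ-false a b b≤a = ¬T⇒≡false (λ t → <⇒≱ (<ᵇ⇒< a b t) b≤a)

<⇒<ᵇ-true : (a b : ℕ) → a < b → (a <ᵇ b) ≡ true
<⇒<ᵇ-true a b a<b = T⇒≡true (<⇒<ᵇ a<b)

legH-above : (n : ℕ) (hs : List ℕ) (a l : ℕ) → l ≤ n → legH n hs a (suc l) ≡ l ∸ nth hs (a ∸ 1)
legH-above n hs a l l≤n =
  trans (countᵇ-map (λ b' → (b' <ᵇ suc l) ∧ inLambdaH hs a b') suc (upTo n))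
    (trans (countᵇ-upTo (λ t → (suc t <ᵇ suc l) ∧ inLambdaH hs a (suc t)) n)
      (sumTo-indicator-interval n h l _ l≤n (λ t _ ft → ≤-pred (<ᵇ⇒< h (suc t) (∧-r ft)) , <ᵇ⇒< t l (∧-l ft))
        (λ t h≤t t<l → ∧-intro (<⇒<ᵇ t<l) (<⇒<ᵇ (s≤s h≤t)))))
  where h = nth hs (a ∸ 1)

dinvCondition-cong : (n : ℕ) {b b' : Bool} {a a' l l' : ℕ} → b ≡ b' → a ≡ a' → l ≡ l' → dinvCondition n b a l ≡ dinvCondition n b' a' l'
dinvCondition-cong n refl refl refl = refl

-- Column 1 contributes legs 0,…,x−1 with arm 0 and legs x,…,x+y−1 with arm 1; column 2 legs 0,…,y−1 with arm 0.
dinvFormula : ℕ → ℕ → ℕ → ℕ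
dinvFormula n x y =
  sumTo x (λ u → ind (dinvCondition n true 0 u)) + sumTo y (λ v → ind (dinvCondition n true 1 (x + v))) + sumTo y (λ u → ind (dinvCondition n true 0 u))

module _ (n h₁ x y : ℕ) (total : h₁ + x + y ≡ n) where
  private
    h₂ : ℕ
    h₂ = h₁ + x
    hs : List ℕ
    hs = h₁ ∷ h₂ ∷ n ∷ []
    h₂≤n : h₂ ≤ n
    h₂≤n = subst (h₂ ≤_) total (m≤m+n h₂ y)
    h₁+[x+y]≡n : h₁ + (x + y) ≡ n
    h₁+[x+y]≡n = trans (sym (+-assoc h₁ x y)) total

    column₃ : sumTo n (λ l → ind (dinvCellH n hs (3 , suc l))) ≡ 0
    column₃ = sumTo-zero n (λ l l<n → cong (λ b → ind (dinvCondition n b (armH hs 3 (suc l)) (legH n hs 3 (suc l)))) (≥⇒<ᵇ-false n (suc l) l<n))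

    column₂ : sumTo n (λ l → ind (dinvCellH n hs (2 , suc l))) ≡ sumTo y (λ u → ind (dinvCondition n true 0 u))
    column₂ = trans (sumTo-dropHead h₂ n _ h₂≤n (λ l l<h₂ → cong (λ b → ind (dinvCondition n b (armH hs 2 (suc l)) (legH n hs 2 (suc l)))) (≥⇒<ᵇ-false h₂ (suc l) l<h₂)))
      (trans (cong (λ z → sumTo z (λ u → ind (dinvCellH n hs (2 , suc (h₂ + u))))) (trans (cong (_∸ h₂) (sym total)) (m+n∸m≡n h₂ y)))
        (sumTo-cong y (λ u u<y → cong ind (dinvCondition-cong n (<ᵇ-suc-+ h₂ u) (noArm u u<y) (legAbove u u<y)))))
      where
      below : ∀ u → u < y → h₂ + u < n
      below u u<y = subst (h₂ + u <_) total (+-monoʳ-< h₂ u<y)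
      noArm : ∀ u → u < y → armH hs 2 (suc (h₂ + u)) ≡ 0
      noArm u u<y = trans (countᵇ-range1-3 (λ a' → (2 <ᵇ a') ∧ inLambdaH hs a' (suc (h₂ + u))))
                        (cong (λ b → ind b + 0) (≥⇒<ᵇ-false n (suc (h₂ + u)) (below u u<y)))
      legAbove : ∀ u → u < y → legH n hs 2 (suc (h₂ + u)) ≡ u
      legAbove u u<y = trans (legH-above n hs 2 (h₂ + u) (<⇒≤ (below u u<y))) (m+n∸m≡n h₂ u)

    column₁ : sumTo n (λ l → ind (dinvCellH n hs (1 , suc l))) ≡
              sumTo x (λ u → ind (dinvCondition n true 0 u)) + sumTo y (λ v → ind (dinvCondition n true 1 (x + v)))
    column₁ = trans (sumTo-dropHead h₁ n _ (≤-trans (m≤m+n h₁ x) h₂≤n) (λ l l<h₁ → cong (λ b → ind (dinvCondition n b (armH hs 1 (suc l)) (legH n hs 1 (suc l)))) (≥⇒<ᵇ-false h₁ (suc l) l<h₁)))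
      (trans (cong (λ z → sumTo z F) (trans (cong (_∸ h₁) (sym h₁+[x+y]≡n)) (m+n∸m≡n h₁ (x + y))))
        (trans (sumTo-+ x y F) (cong₂ _+_ (sumTo-cong x armZero) (sumTo-cong y armOne))))
      where
      F : ℕ → ℕ
      F = λ u → ind (dinvCellH n hs (1 , suc (h₁ + u)))
      below : ∀ u → u < x + y → h₁ + u < n
      below u u< = subst (h₁ + u <_) h₁+[x+y]≡n (+-monoʳ-< h₁ u<)
      legAbove : ∀ u → u < x + y → legH n hs 1 (suc (h₁ + u)) ≡ u
      legAbove u u< = trans (legH-above n hs 1 (h₁ + u) (<⇒≤ (below u u<))) (m+n∸m≡n h₁ u)
      armZero : ∀ u → u < x → F u ≡ ind (dinvCondition n true 0 u)
      armZero u u<x = cong ind (dinvCondition-cong n (<ᵇ-suc-+ h₁ u)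
        (trans (countᵇ-range1-3 (λ a' → (1 <ᵇ a') ∧ inLambdaH hs a' (suc (h₁ + u))))
               (cong₂ (λ b c → ind b + (ind c + 0)) (≥⇒<ᵇ-false h₂ (suc (h₁ + u)) (+-monoʳ-< h₁ u<x))
                                                     (≥⇒<ᵇ-false n (suc (h₁ + u)) (below u (≤-trans u<x (m≤m+n x y))))))
        (legAbove u (≤-trans u<x (m≤m+n x y))))
      armOne : ∀ v → v < y → F (x + v) ≡ ind (dinvCondition n true 1 (x + v))
      armOne v v<y = cong ind (dinvCondition-cong n (<ᵇ-suc-+ h₁ (x + v))
        (trans (countᵇ-range1-3 (λ a' → (1 <ᵇ a') ∧ inLambdaH hs a' (suc (h₁ + (x + v)))))
               (cong₂ (λ b c → ind b + (ind c + 0)) (<⇒<ᵇ-true h₂ (suc (h₁ + (x + v))) (s≤s (+-monoʳ-≤ h₁ (m≤m+n x v))))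
                                                     (≥⇒<ᵇ-false n (suc (h₁ + (x + v))) (below (x + v) (+-monoʳ-< x v<y)))))
        (legAbove (x + v) (+-monoʳ-< x v<y)))

  dinvH-heights : dinvH n (h₁ ∷ h₁ + x ∷ n ∷ []) ≡ dinvFormula n x y
  dinvH-heights = trans (countᵇ-cells n (dinvCellH n hs)) (trans (cong₂ _+_ column₁ (cong₂ _+_ column₂ (cong (_+ 0) column₃)))
    (cong (sumTo x (λ u → ind (dinvCondition n true 0 u)) + sumTo y (λ v → ind (dinvCondition n true 1 (x + v))) +_)
          (+-identityʳ (sumTo y (λ u → ind (dinvCondition n true 0 u))))))

module Threshold (n m : ℕ) (3m<n : 3 * m < n) (n≤3m+2 : n ≤ 3 * m + 2) where

  n<3[1+m] : n < 3 * suc m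
  n<3[1+m] = ≤-<-trans n≤3m+2 (subst (3 * m + 2 <_) (+3 m) (+-monoʳ-< (3 * m) (s≤s (s≤s (s≤s z≤n)))))
    where
    +3 : ∀ m → 3 * m + 3 ≡ 3 * suc m
    +3 = solve-∀

  3u<n⇒u≤m : ∀ u → 3 * u < n → u ≤ m
  3u<n⇒u≤m u h = ≤-pred (*-cancelˡ-< 3 u (suc m) (<-trans h n<3[1+m]))

  u≤m⇒3u<n : ∀ u → u ≤ m → 3 * u < n
  u≤m⇒3u<n u h = ≤-<-trans (*-monoʳ-≤ 3 h) 3m<n

  n≤3l⇒m<l : ∀ l → n ≤ 3 * l → m < l
  n≤3l⇒m<l l h = ≰⇒> (λ l≤m → <⇒≱ (u≤m⇒3u<n l l≤m) h)

  m<l⇒n≤3l : ∀ l → m < l → n ≤ 3 * l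
  m<l⇒n≤3l l h = <⇒≤ (<-≤-trans n<3[1+m] (*-monoʳ-≤ 3 h))

  n<3[1+t]⇒m≤t : ∀ t → n < 3 * suc t → m ≤ t
  n<3[1+t]⇒m≤t t h = ≮⇒≥ (λ t<m → <⇒≱ h (<⇒≤ (u≤m⇒3u<n (suc t) t<m)))

  m≤t⇒n<3[1+t] : ∀ t → m ≤ t → n < 3 * suc t
  m≤t⇒n<3[1+t] t h = <-≤-trans n<3[1+m] (*-monoʳ-≤ 3 (s≤s h))

  dinvArmZero⇒ : ∀ u → T (dinvCondition n true 0 u) → u ≤ m
  dinvArmZero⇒ u t = 3u<n⇒u≤m u (subst (3 * u <_) (*-identityʳ n) (<ᵇ⇒< _ _ (∧-r t)))

  dinvArmZero⇐ : ∀ u → u ≤ m → T (dinvCondition n true 0 u)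
  dinvArmZero⇐ u h =
    ∧-intro (<⇒<ᵇ (subst (_< 3 * (u + 1)) (sym (*-zeroʳ n)) (<-≤-trans (s≤s z≤n) (*-monoʳ-≤ 3 (m≤n+m 1 u)))))
            (<⇒<ᵇ (subst (3 * u <_) (sym (*-identityʳ n)) (u≤m⇒3u<n u h)))

  dinvArmOneLeft⇒ : ∀ t → T (n * 1 <ᵇ 3 * (t + 1)) → m ≤ t
  dinvArmOneLeft⇒ t x = n<3[1+t]⇒m≤t t (subst₂ _<_ (*-identityʳ n) (cong (3 *_) (+-comm t 1)) (<ᵇ⇒< _ _ x))

  dinvArmOneLeft⇐ : ∀ t → m ≤ t → T (n * 1 <ᵇ 3 * (t + 1))
  dinvArmOneLeft⇐ t h = <⇒<ᵇ (subst₂ _<_ (sym (*-identityʳ n)) (cong (3 *_) (+-comm 1 t)) (m≤t⇒n<3[1+t] t h))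

  areaCell⇒ : ∀ h l → T (not (h <ᵇ suc l) ∧ (n ≤ᵇ 3 * l)) → m < l × l < h
  areaCell⇒ h l t = n≤3l⇒m<l l (≤ᵇ⇒≤ _ _ (∧-r t)) , ≰⇒> (λ h≤l → T-not→¬T (∧-l t) (<⇒<ᵇ (s≤s h≤l)))

  areaCell⇐ : ∀ h l → m < l → l < h → T (not (h <ᵇ suc l) ∧ (n ≤ᵇ 3 * l))
  areaCell⇐ h l m<l l<h = ∧-intro (¬T→T-not (λ x → <⇒≱ l<h (≤-pred (<ᵇ⇒< h (suc l) x)))) (≤⇒≤ᵇ (m<l⇒n≤3l l m<l))

private
  residue-bounds : ∀ {n m e} → n ≡ 3 * m + suc e → e ≤ 1 → 3 * m < n × n ≤ 3 * m + 2
  residue-bounds {m = m} refl e≤1 = m<m+n (3 * m) z<s , +-monoʳ-≤ (3 * m) (s≤s e≤1)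

  double-residue : ∀ m e → e ≤ 1 → (3 * m + suc e) * 2 ≡ 3 * (m + m + e) + suc (1 ∸ e)
  double-residue m .0 z≤n       = identity m
    where
    identity : ∀ m → (3 * m + 1) * 2 ≡ 3 * (m + m + 0) + 2
    identity = solve-∀
  double-residue m .1 (s≤s z≤n) = identity m
    where
    identity : ∀ m → (3 * m + 2) * 2 ≡ 3 * (m + m + 1) + 1
    identity = solve-∀

-- n = 3m + 1 + e with e ≤ 1, so that m = ⌊n/3⌋ and m' = m + m + e = ⌊2n/3⌋.
module Residue (n m e : ℕ) (n≡ : n ≡ 3 * m + suc e) (e≤1 : e ≤ 1) where

  m' : ℕ
  m' = m + m + e

  n≡m'+1+m : n ≡ m' + suc m
  n≡m'+1+m = trans n≡ (shuffle m e)
    where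
    shuffle : ∀ m e → 3 * m + suc e ≡ m + m + e + suc m
    shuffle = solve-∀

  m'≤n : m' ≤ n
  m'≤n = subst (m' ≤_) (sym n≡m'+1+m) (m≤m+n m' (suc m))

  m≤m' : m ≤ m'
  m≤m' = ≤-trans (m≤m+n m m) (m≤m+n (m + m) e)

  private
    bounds₁ : 3 * m < n × n ≤ 3 * m + 2
    bounds₁ = residue-bounds {m = m} n≡ e≤1
    bounds₂ : 3 * m' < n * 2 × n * 2 ≤ 3 * m' + 2
    bounds₂ = residue-bounds {m = m'} (trans (cong (_* 2) n≡) (double-residue m e e≤1)) (m∸n≤m 1 e)

  module T₁ = Threshold n m (proj₁ bounds₁) (proj₂ bounds₁)
  module T₂ = Threshold (n * 2) m' (proj₁ bounds₂) (proj₂ bounds₂)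

  areaH-heights : (h₁ h₂ : ℕ) → h₁ ≤ n → h₂ ≤ n → areaH n (h₁ ∷ h₂ ∷ n ∷ []) ≡ (h₁ ∸ suc m) + (h₂ ∸ suc m')
  areaH-heights h₁ h₂ h₁≤n h₂≤n = trans (countᵇ-cells n (areaCellH n hs)) (cong₂ _+_ column₁ (trans (cong₂ _+_ column₂ column₃) (+-identityʳ _)))
    where
    hs : List ℕ
    hs = h₁ ∷ h₂ ∷ n ∷ []
    column₁ : sumTo n (λ l → ind (areaCellH n hs (1 , suc l))) ≡ h₁ ∸ suc m
    column₁ = trans (sumTo-cong n (λ l _ → cong (λ z → ind (not (h₁ <ᵇ suc l) ∧ (z ≤ᵇ 3 * l))) (*-identityʳ n)))
      (sumTo-indicator-interval n (suc m) h₁ (λ l → not (h₁ <ᵇ suc l) ∧ (n ≤ᵇ 3 * l)) h₁≤n (λ l _ → T₁.areaCell⇒ h₁ l) (T₁.areaCell⇐ h₁))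
    column₂ : sumTo n (λ l → ind (areaCellH n hs (2 , suc l))) ≡ h₂ ∸ suc m'
    column₂ = sumTo-indicator-interval n (suc m') h₂ (λ l → not (h₂ <ᵇ suc l) ∧ (n * 2 ≤ᵇ 3 * l)) h₂≤n (λ l _ → T₂.areaCell⇒ h₂ l) (T₂.areaCell⇐ h₂)
    column₃ : sumTo n (λ l → ind (areaCellH n hs (3 , suc l))) + 0 ≡ 0
    column₃ = trans (+-identityʳ _) (sumTo-zero n (λ l l<n → ind-false (λ t → <⇒≱ l<n (*3-cancel n l (≤ᵇ⇒≤ _ _ (∧-r t))))))

  sumTo-armZero-upTo : (x : ℕ) → x ≤ suc m → sumTo x (λ u → ind (dinvCondition n true 0 u)) ≡ x
  sumTo-armZero-upTo x x≤1+m = sumTo-indicator-interval x 0 x (dinvCondition n true 0) ≤-refl (λ u u<x _ → z≤n , u<x)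
    (λ u _ u<x → T₁.dinvArmZero⇐ u (≤-pred (<-≤-trans u<x x≤1+m)))

  sumTo-armZero-beyond : (x : ℕ) → suc m ≤ x → sumTo x (λ u → ind (dinvCondition n true 0 u)) ≡ suc m
  sumTo-armZero-beyond x m<x = sumTo-indicator-interval x 0 (suc m) (dinvCondition n true 0) m<x (λ u _ t → z≤n , s≤s (T₁.dinvArmZero⇒ u t))
    (λ u _ u≤m → T₁.dinvArmZero⇐ u (≤-pred u≤m))

  dinvArmOne⇒ : ∀ t → T (dinvCondition n true 1 t) → m ≤ t × t ≤ m'
  dinvArmOne⇒ t x = T₁.dinvArmOneLeft⇒ t (∧-l x) , T₂.3u<n⇒u≤m t (<ᵇ⇒< _ _ (∧-r x))

  dinvArmOne⇐ : ∀ t → m ≤ t → t ≤ m' → T (dinvCondition n true 1 t)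
  dinvArmOne⇐ t m≤t t≤m' = ∧-intro (T₁.dinvArmOneLeft⇐ t m≤t) (<⇒<ᵇ (T₂.u≤m⇒3u<n t t≤m'))

  sumTo-armOne-none : (x y : ℕ) → x + y ≤ m → sumTo y (λ v → ind (dinvCondition n true 1 (x + v))) ≡ 0
  sumTo-armOne-none x y x+y≤m = sumTo-zero y (λ v v<y → ind-false (λ t → <⇒≱ (<-≤-trans (+-monoʳ-< x v<y) x+y≤m) (proj₁ (dinvArmOne⇒ (x + v) t))))

  sumTo-armOne-crossing : (K v' r : ℕ) → m ≡ K + (r + suc v') →
    sumTo (r + suc v') (λ v → ind (dinvCondition n true 1 (K + suc v' + v))) ≡ suc v'
  sumTo-armOne-crossing K v' r m≡ =
    trans (sumTo-indicator-interval (r + suc v') r (r + suc v') _ ≤-refl sound complete) (m+n∸m≡n r (suc v'))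
    where
    swap : ∀ K v' v → K + suc v' + v ≡ K + (v + suc v')
    swap = solve-∀
    regroup : ∀ K v' r → K + suc v' + (r + suc v') ≡ K + (r + suc v') + suc v'
    regroup = solve-∀
    sound : ∀ v → v < r + suc v' → T (dinvCondition n true 1 (K + suc v' + v)) → r ≤ v × v < r + suc v'
    sound v v< t = +-cancelʳ-≤ (suc v') r v (+-cancelˡ-≤ K (r + suc v') (v + suc v') (subst₂ _≤_ m≡ (swap K v' v) (proj₁ (dinvArmOne⇒ _ t)))) , v<
    v'<m : suc v' ≤ m
    v'<m = subst (suc v' ≤_) (trans (+-assoc K r (suc v')) (sym m≡)) (m≤n+m (suc v') (K + r))
    m+1+v'≤m' : m + suc v' ≤ m'
    m+1+v'≤m' = ≤-trans (+-monoʳ-≤ m v'<m) (m≤m+n (m + m) e)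
    complete : ∀ v → r ≤ v → v < r + suc v' → T (dinvCondition n true 1 (K + suc v' + v))
    complete v r≤v v< = dinvArmOne⇐ _ (subst₂ _≤_ (sym m≡) (sym (swap K v' v)) (+-monoʳ-≤ K (+-monoˡ-≤ (suc v') r≤v)))
      (<⇒≤ (<-≤-trans (+-monoʳ-< (K + suc v') v<) (≤-trans (≤-reflexive (trans (regroup K v' r) (cong (_+ suc v') (sym m≡)))) m+1+v'≤m')))

  sumTo-armOne-all : (w y : ℕ) → w + y < m + e → sumTo y (λ v → ind (dinvCondition n true 1 (suc m + w + v))) ≡ y
  sumTo-armOne-all w y w+y< = sumTo-indicator-interval y 0 y _ ≤-refl (λ v v<y _ → z≤n , v<y)
    (λ v _ v<y → dinvArmOne⇐ _ (≤-trans (n≤1+n m) (≤-trans (m≤m+n (suc m) w) (m≤m+n (suc m + w) v)))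
      (subst (_≤ m') (regroup m w v) (≤-trans (+-monoʳ-≤ m (<-trans (+-monoʳ-< w v<y) w+y<)) (≤-reflexive (sym (+-assoc m m e))))))
    where
    regroup : ∀ m w v → m + suc (w + v) ≡ suc m + w + v
    regroup = solve-∀

private
  ≡+⇒∸≡ : ∀ {a b c} → a ≡ c + b → a ∸ b ≡ c
  ≡+⇒∸≡ {b = b} {c} a≡ = trans (cong (_∸ b) a≡) (m+n∸n≡m c b)

  ≡+⇒∸∸∸≡ : ∀ {a b c d} → a ≡ d + (b + c + 1) → a ∸ b ∸ c ∸ 1 ≡ d
  ≡+⇒∸∸∸≡ {a} {b} {c} a≡ = trans (cong (_∸ 1) (∸-+-assoc a b c)) (trans (∸-+-assoc a (b + c) 1) (≡+⇒∸≡ a≡))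

-- The monomial (n − a − s − 1 , a) of rhs2 at a = s + (3L + e − t'), where L = m − s, in each of the three regimes.

rhsEntry-shallow : ∀ n m e s L t' q → n ≡ 3 * m + suc e → m ≡ s + L → L ≡ t' + q →
  let a = s + ((suc L + (L + L + e)) ∸ suc t') in
  (n ∸ a ∸ s ∸ 1 ≡ t' + 0 + s) × (a ≡ ((m + m + e) ∸ (t' + s)) + (m ∸ s))
rhsEntry-shallow ._ ._ e s ._ t' q refl refl refl = dinvPart , areaPart
  where
  L : ℕ
  L = t' + q
  m'-split : ∀ s t' q e → s + (t' + q) + (s + (t' + q)) + e ≡ s + t' + q + q + e + (t' + s)
  m'-split = solve-∀
  offset : (suc L + (L + L + e)) ∸ suc t' ≡ q + L + L + e
  offset = ≡+⇒∸≡ (identity t' q e)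
    where
    identity : ∀ t' q e → suc (t' + q) + ((t' + q) + (t' + q) + e) ≡ q + (t' + q) + (t' + q) + e + suc t'
    identity = solve-∀
  dinvPart : (3 * (s + L) + suc e) ∸ (s + ((suc L + (L + L + e)) ∸ suc t')) ∸ s ∸ 1 ≡ t' + 0 + s
  dinvPart rewrite offset = ≡+⇒∸∸∸≡ {b = s + (q + L + L + e)} {c = s} (identity s t' q e)
    where
    identity : ∀ s t' q e → 3 * (s + (t' + q)) + suc e ≡ t' + 0 + s + (s + (q + (t' + q) + (t' + q) + e) + s + 1)
    identity = solve-∀
  areaPart : s + ((suc L + (L + L + e)) ∸ suc t') ≡ ((s + L + (s + L) + e) ∸ (t' + s)) + ((s + L) ∸ s)
  areaPart rewrite offset | m+n∸m≡n s L | ≡+⇒∸≡ {s + L + (s + L) + e} {t' + s} {s + t' + q + q + e} (m'-split s t' q e) = identity s t' q e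
    where
    identity : ∀ s t' q e → s + (q + (t' + q) + (t' + q) + e) ≡ s + t' + q + q + e + (t' + q)
    identity = solve-∀

rhsEntry-crossing : ∀ n m e s L w q → n ≡ 3 * m + suc e → m ≡ s + L → L ≡ suc (w + q) →
  let a = s + ((suc L + (L + L + e)) ∸ suc (suc L + suc (w + w))) ; x = suc (m ∸ (s + suc w)) + w ; y = s + suc w in
  (n ∸ a ∸ s ∸ 1 ≡ x + suc w + y) × (a ≡ ((m + m + e) ∸ (x + y)) + (m ∸ y))
rhsEntry-crossing ._ ._ e s ._ w q refl refl refl = dinvPart , areaPart
  where
  L : ℕ
  L = suc (w + q)
  m'-split : ∀ s w q e → s + suc (w + q) + (s + suc (w + q)) + e ≡ s + q + e + (suc q + w + (s + suc w))
  m'-split = solve-∀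
  offset : (suc L + (L + L + e)) ∸ suc (suc L + suc (w + w)) ≡ q + q + e
  offset = ≡+⇒∸≡ (identity w q e)
    where
    identity : ∀ w q e → suc (suc (w + q)) + (suc (w + q) + suc (w + q) + e) ≡ q + q + e + suc (suc (suc (w + q)) + suc (w + w))
    identity = solve-∀
  m∸y : (s + L) ∸ (s + suc w) ≡ q
  m∸y = ≡+⇒∸≡ (identity s w q)
    where
    identity : ∀ s w q → s + suc (w + q) ≡ q + (s + suc w)
    identity = solve-∀
  dinvPart : (3 * (s + L) + suc e) ∸ (s + ((suc L + (L + L + e)) ∸ suc (suc L + suc (w + w)))) ∸ s ∸ 1
             ≡ suc ((s + L) ∸ (s + suc w)) + w + suc w + (s + suc w)
  dinvPart rewrite offset | m∸y = ≡+⇒∸∸∸≡ {b = s + (q + q + e)} {c = s} (identity s w q e)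
    where
    identity : ∀ s w q e → 3 * (s + suc (w + q)) + suc e ≡ suc q + w + suc w + (s + suc w) + (s + (q + q + e) + s + 1)
    identity = solve-∀
  areaPart : s + ((suc L + (L + L + e)) ∸ suc (suc L + suc (w + w)))
             ≡ ((s + L + (s + L) + e) ∸ ((suc ((s + L) ∸ (s + suc w)) + w) + (s + suc w))) + ((s + L) ∸ (s + suc w))
  areaPart rewrite offset | m∸y | ≡+⇒∸≡ {s + L + (s + L) + e} {suc q + w + (s + suc w)} {s + q + e} (m'-split s w q e) = identity s q e
    where
    identity : ∀ s q e → s + (q + q + e) ≡ s + q + e + q
    identity = solve-∀

rhsEntry-wide : ∀ n m e s L w → e ≤ 1 → n ≡ 3 * m + suc e → m ≡ s + L → w < L + e →
  let a = s + ((suc L + (L + L + e)) ∸ suc (suc L + (w + w))) in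
  (n ∸ a ∸ s ∸ 1 ≡ suc m + w + w) × (a ≡ ((m + m + e) ∸ (suc m + s + w)) + (m ∸ w))
rhsEntry-wide ._ ._ .0 s L w z≤n refl refl w<L+0 with m≤n⇒∃[o]m+o≡n (subst (suc w ≤_) (+-identityʳ L) w<L+0)
... | p , refl = dinvPart , areaPart
  where
  m'-split : ∀ s w p → s + suc (w + p) + (s + suc (w + p)) + 0 ≡ p + (suc (s + suc (w + p)) + s + w)
  m'-split = solve-∀
  m-split : ∀ s w p → s + suc (w + p) ≡ s + suc p + w
  m-split = solve-∀
  offset : (suc L + (L + L + 0)) ∸ suc (suc L + (w + w)) ≡ suc (p + p)
  offset = ≡+⇒∸≡ (identity w p)
    where
    identity : ∀ w p → suc (suc (w + p)) + (suc (w + p) + suc (w + p) + 0) ≡ suc (p + p) + suc (suc (suc (w + p)) + (w + w))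
    identity = solve-∀
  dinvPart : (3 * (s + L) + suc 0) ∸ (s + ((suc L + (L + L + 0)) ∸ suc (suc L + (w + w)))) ∸ s ∸ 1 ≡ suc (s + L) + w + w
  dinvPart rewrite offset = ≡+⇒∸∸∸≡ {b = s + suc (p + p)} {c = s} (identity s w p)
    where
    identity : ∀ s w p → 3 * (s + suc (w + p)) + suc 0 ≡ suc (s + suc (w + p)) + w + w + (s + suc (p + p) + s + 1)
    identity = solve-∀
  areaPart : s + ((suc L + (L + L + 0)) ∸ suc (suc L + (w + w))) ≡ ((s + L + (s + L) + 0) ∸ (suc (s + L) + s + w)) + ((s + L) ∸ w)
  areaPart rewrite offset | ≡+⇒∸≡ {s + L + (s + L) + 0} {suc (s + L) + s + w} {p} (m'-split s w p) | ≡+⇒∸≡ {s + L} {w} {s + suc p} (m-split s w p) = identity s p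
    where
    identity : ∀ s p → s + suc (p + p) ≡ p + (s + suc p)
    identity = solve-∀
rhsEntry-wide ._ ._ .1 s L w (s≤s z≤n) refl refl w<L+1 with m≤n⇒∃[o]m+o≡n (≤-pred (subst (suc w ≤_) (+-comm L 1) w<L+1))
... | p , refl = dinvPart , areaPart
  where
  m'-split : ∀ s w p → s + (w + p) + (s + (w + p)) + 1 ≡ p + (suc (s + (w + p)) + s + w)
  m'-split = solve-∀
  m-split : ∀ s w p → s + (w + p) ≡ s + p + w
  m-split = solve-∀
  offset : (suc L + (L + L + 1)) ∸ suc (suc L + (w + w)) ≡ p + p
  offset = ≡+⇒∸≡ (identity w p)
    where
    identity : ∀ w p → suc (w + p) + ((w + p) + (w + p) + 1) ≡ p + p + suc (suc (w + p) + (w + w))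
    identity = solve-∀
  dinvPart : (3 * (s + L) + suc 1) ∸ (s + ((suc L + (L + L + 1)) ∸ suc (suc L + (w + w)))) ∸ s ∸ 1 ≡ suc (s + L) + w + w
  dinvPart rewrite offset = ≡+⇒∸∸∸≡ {b = s + (p + p)} {c = s} (identity s w p)
    where
    identity : ∀ s w p → 3 * (s + (w + p)) + suc 1 ≡ suc (s + (w + p)) + w + w + (s + (p + p) + s + 1)
    identity = solve-∀
  areaPart : s + ((suc L + (L + L + 1)) ∸ suc (suc L + (w + w))) ≡ ((s + L + (s + L) + 1) ∸ (suc (s + L) + s + w)) + ((s + L) ∸ w)
  areaPart rewrite offset | ≡+⇒∸≡ {s + L + (s + L) + 1} {suc (s + L) + s + w} {p} (m'-split s w p) | ≡+⇒∸≡ {s + L} {w} {s + p} (m-split s w p) = identity s p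
    where
    identity : ∀ s p → s + (p + p) ≡ p + (s + p)
    identity = solve-∀

_≋_ : Poly → Poly → Set
P ≋ Q = (g : ℕ × ℕ → Bool) → countᵇ g P ≡ countᵇ g Q

≋⇒coeff≡ : {P Q : Poly} → P ≋ Q → (i j : ℕ) → coeff P i j ≡ coeff Q i j
≋⇒coeff≡ P≋Q i j = P≋Q _

rhs1Condition : ℕ → ℕ → ℕ → ℕ → Bool
rhs1Condition n s a d = (s ≤ᵇ a) ∧ (s ≤ᵇ d) ∧ (a + s + d + 1 ≡ᵇ n)

rhs2Condition : ℕ → ℕ → ℕ → Bool
rhs2Condition n s a = (s ≤ᵇ a) ∧ (a + 2 * s + 1 ≤ᵇ n)

module _ (n : ℕ) (g : ℕ × ℕ → Bool) where

  countᵇ-rhs1 : countᵇ g (rhs1 n) ≡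
    sumTo (suc (n / 3)) (λ s → sumTo (suc n) (λ a → sumTo (suc n) (λ d → ind (rhs1Condition n s a d ∧ g (d , a)))))
  countᵇ-rhs1 =
    trans (countᵇ-concatMap-applyUpTo g (λ s → concatMap (λ a → map (λ d → (d , a)) (filterᵇ (rhs1Condition n s a) (range0 n))) (range0 n)) (λ j → j) (suc (n / 3)))
      (sumTo-cong (suc (n / 3)) (λ s _ →
        trans (countᵇ-concatMap-applyUpTo g (λ a → map (λ d → (d , a)) (filterᵇ (rhs1Condition n s a) (range0 n))) (λ j → j) (suc n))
          (sumTo-cong (suc n) (λ a _ →
            trans (countᵇ-map g (λ d → (d , a)) (filterᵇ (rhs1Condition n s a) (range0 n)))
              (trans (countᵇ-filterᵇ (rhs1Condition n s a) (λ d → g (d , a)) (range0 n)) (countᵇ-upTo (λ d → rhs1Condition n s a d ∧ g (d , a)) (suc n)))))))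

  countᵇ-rhs2 : countᵇ g (rhs2 n) ≡ sumTo (suc (n / 3)) (λ s → sumTo (suc n) (λ a → ind (rhs2Condition n s a ∧ g (n ∸ a ∸ s ∸ 1 , a))))
  countᵇ-rhs2 =
    trans (countᵇ-concatMap-applyUpTo g (λ s → map (λ a → (n ∸ a ∸ s ∸ 1 , a)) (filterᵇ (rhs2Condition n s) (range0 n))) (λ j → j) (suc (n / 3)))
      (sumTo-cong (suc (n / 3)) (λ s _ →
        trans (countᵇ-map g (λ a → (n ∸ a ∸ s ∸ 1 , a)) (filterᵇ (rhs2Condition n s) (range0 n)))
          (trans (countᵇ-filterᵇ (rhs2Condition n s) (λ a → g (n ∸ a ∸ s ∸ 1 , a)) (range0 n))
            (countᵇ-upTo (λ a → rhs2Condition n s a ∧ g (n ∸ a ∸ s ∸ 1 , a)) (suc n)))))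

  -- For given s and a, the only candidate d is n − a − s − 1.
  sumTo-rhs1Condition : ∀ s a → sumTo (suc n) (λ d → ind (rhs1Condition n s a d ∧ g (d , a))) ≡ ind (rhs2Condition n s a ∧ g (n ∸ a ∸ s ∸ 1 , a))
  sumTo-rhs1Condition s a with s ≤? a | a + 2 * s + 1 ≤? n
  ... | no s≰a | _ = trans (sumTo-zero (suc n) (λ d _ → ind-false {rhs1Condition n s a d ∧ g (d , a)} (λ t → s≰a (≤ᵇ⇒≤ _ _ (∧-l {s ≤ᵇ a} (∧-l {rhs1Condition n s a d} t))))))
                           (sym (ind-false {rhs2Condition n s a ∧ g (n ∸ a ∸ s ∸ 1 , a)} (λ t → s≰a (≤ᵇ⇒≤ _ _ (∧-l {s ≤ᵇ a} (∧-l {rhs2Condition n s a} t))))))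
  ... | yes s≤a | no tooBig = trans (sumTo-zero (suc n) (λ d _ → ind-false {rhs1Condition n s a d ∧ g (d , a)} (λ t → tooBig (fits d t))))
                                    (sym (ind-false {rhs2Condition n s a ∧ g (n ∸ a ∸ s ∸ 1 , a)} (λ t → tooBig (≤ᵇ⇒≤ _ _ (∧-r {s ≤ᵇ a} (∧-l {rhs2Condition n s a} t))))))
    where
    double : ∀ a s → a + s + s + 1 ≡ a + 2 * s + 1
    double = solve-∀
    fits : ∀ d → T (rhs1Condition n s a d ∧ g (d , a)) → a + 2 * s + 1 ≤ n
    fits d t = subst (a + 2 * s + 1 ≤_) (≡ᵇ⇒≡ _ _ (∧-r {s ≤ᵇ d} (∧-r {s ≤ᵇ a} (∧-l {rhs1Condition n s a d} t))))
                 (subst (_≤ a + s + d + 1) (double a s) (+-monoˡ-≤ 1 (+-monoʳ-≤ (a + s) (≤ᵇ⇒≤ _ _ (∧-l {s ≤ᵇ d} (∧-r {s ≤ᵇ a} (∧-l {rhs1Condition n s a d} t)))))))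
  ... | yes s≤a | yes fits = trans (sumTo-single (suc n) c _ (s≤s c≤n) othersFail)
                                   (cong (λ b → ind (b ∧ g (c , a))) (trans (T⇒≡true (∧-intro (≤⇒≤ᵇ s≤a) (∧-intro (≤⇒≤ᵇ s≤c) (≡⇒≡ᵇ _ _ total))))
                                                                             (sym (T⇒≡true (∧-intro (≤⇒≤ᵇ s≤a) (≤⇒≤ᵇ fits))))))
    where
    c : ℕ
    c = n ∸ a ∸ s ∸ 1
    k : ℕ
    k = n ∸ (a + 2 * s + 1)
    n≡k+ : n ≡ k + (a + 2 * s + 1)
    n≡k+ = sym (m∸n+n≡m fits)
    c≡k+s : c ≡ k + s
    c≡k+s = ≡+⇒∸∸∸≡ {b = a} {c = s} (trans n≡k+ (identity k a s))
      where
      identity : ∀ k a s → k + (a + 2 * s + 1) ≡ k + s + (a + s + 1)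
      identity = solve-∀
    total : a + s + c + 1 ≡ n
    total = trans (cong (λ z → a + s + z + 1) c≡k+s) (trans (identity k a s) (sym n≡k+))
      where
      identity : ∀ k a s → a + s + (k + s) + 1 ≡ k + (a + 2 * s + 1)
      identity = solve-∀
    s≤c : s ≤ c
    s≤c = subst (s ≤_) (sym c≡k+s) (m≤n+m s k)
    c≤n : c ≤ n
    c≤n = subst (c ≤_) total (≤-trans (m≤n+m c (a + s)) (m≤m+n (a + s + c) 1))
    othersFail : ∀ d → d < suc n → d ≢ c → ind (rhs1Condition n s a d ∧ g (d , a)) ≡ 0
    othersFail d _ d≢c = ind-false λ t → d≢c (+-cancelˡ-≡ (a + s) d c (+-cancelʳ-≡ 1 (a + s + d) (a + s + c)
      (trans (≡ᵇ⇒≡ _ _ (∧-r {s ≤ᵇ d} (∧-r {s ≤ᵇ a} (∧-l {rhs1Condition n s a d} t)))) (sym total))))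

rhs1≋rhs2 : (n : ℕ) → rhs1 n ≋ rhs2 n
rhs1≋rhs2 n g = trans (countᵇ-rhs1 n g) (trans (sumTo-cong (suc (n / 3)) (λ s _ → sumTo-cong (suc n) (λ a _ → sumTo-rhs1Condition n g s a)))
                                               (sym (countᵇ-rhs2 n g)))

module Counting (n m e : ℕ) (n≡ : n ≡ 3 * m + suc e) (e≤1 : e ≤ 1) (g : ℕ × ℕ → Bool) where
  open Residue n m e n≡ e≤1

  -- The path with x = h₂ − h₁ and y = n − h₂.
  countedAt : ℕ → ℕ → ℕ
  countedAt x y = ind (heightsCounted n g ((suc n ∸ x) ∸ suc y) x)

  weight : ℕ → ℕ → ℕ
  weight x y = ind (g (dinvFormula n x y , (m' ∸ (x + y)) + (m ∸ y)))

  countᵇ-catalan3-xy : countᵇ g (catalan3 n) ≡ sumTo (suc n) (λ y → sumTo (suc n ∸ y) (λ x → countedAt x y))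
  countᵇ-catalan3-xy = begin
    countᵇ g (catalan3 n)
      ≡⟨ countᵇ-catalan3-heights n g ⟩
    sumTo (suc n) (λ h₁ → sumTo (suc n ∸ h₁) (λ x → ind (heightsCounted n g h₁ x)))
      ≡⟨ sumTo-triangle-transpose (suc n) (λ h₁ x → ind (heightsCounted n g h₁ x)) ⟩
    sumTo (suc n) (λ x → sumTo (suc n ∸ x) (λ h₁ → ind (heightsCounted n g h₁ x)))
      ≡⟨ sumTo-cong (suc n) (λ x _ → sumTo-reverse (suc n ∸ x) (λ h₁ → ind (heightsCounted n g h₁ x))) ⟩
    sumTo (suc n) (λ x → sumTo (suc n ∸ x) (λ y → countedAt x y))
      ≡⟨ sumTo-triangle-transpose (suc n) countedAt ⟩
    sumTo (suc n) (λ y → sumTo (suc n ∸ y) (λ x → countedAt x y)) ∎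
    where open ≡-Reasoning

  private
    module AtXY (x y : ℕ) (x+y≤n : x + y ≤ n) where
      h₁ : ℕ
      h₁ = (suc n ∸ x) ∸ suc y

      h₁+[x+y]≡n : h₁ + (x + y) ≡ n
      h₁+[x+y]≡n = trans (cong (_+ (x + y)) (trans (cong (_∸ suc y) (+-∸-assoc 1 (≤-trans (m≤m+n x y) x+y≤n))) (∸-+-assoc n x y))) (m∸n+n≡m x+y≤n)

      total : h₁ + x + y ≡ n
      total = trans (+-assoc h₁ x y) h₁+[x+y]≡n

      h₁+x≤n : h₁ + x ≤ n
      h₁+x≤n = subst (h₁ + x ≤_) total (m≤m+n (h₁ + x) y)

      h₁≤n : h₁ ≤ n
      h₁≤n = ≤-trans (m≤m+n h₁ x) h₁+x≤n

      firstAbove : T (heightsCounted n g h₁ x) → suc m ≤ h₁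
      firstAbove t = T₁.n≤3l⇒m<l h₁ (≤ᵇ⇒≤ _ _ (∧-l {n ≤ᵇ 3 * h₁} (∧-l {(n ≤ᵇ 3 * h₁) ∧ (n * 2 ≤ᵇ 3 * (h₁ + x))} t)))

      secondAbove : T (heightsCounted n g h₁ x) → suc m' ≤ h₁ + x
      secondAbove t = T₂.n≤3l⇒m<l (h₁ + x) (≤ᵇ⇒≤ _ _ (∧-r {n ≤ᵇ 3 * h₁} (∧-l {(n ≤ᵇ 3 * h₁) ∧ (n * 2 ≤ᵇ 3 * (h₁ + x))} t)))

  countedAt-beyond-y : ∀ x y → suc m ≤ y → x + y ≤ n → countedAt x y ≡ 0
  countedAt-beyond-y x y m<y x+y≤n = ind-false λ t → <-irrefl (trans (sym n≡m'+1+m) (sym total)) (+-mono-≤ (secondAbove t) m<y)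
    where open AtXY x y x+y≤n

  countedAt-beyond-x+y : ∀ x y → suc m' ≤ x + y → x + y ≤ n → countedAt x y ≡ 0
  countedAt-beyond-x+y x y m'<x+y x+y≤n =
    ind-false λ t → <-irrefl (trans (sym n≡m'+1+m) (sym h₁+[x+y]≡n)) (subst (m' + suc m <_) (+-comm (x + y) h₁) (+-mono-≤ m'<x+y (firstAbove t)))
    where open AtXY x y x+y≤n

  countedAt≡weight : ∀ x y → y ≤ m → x + y ≤ m' → countedAt x y ≡ weight x y
  countedAt≡weight x y y≤m x+y≤m' = cong ind (lemma
      (T⇒≡true (≤⇒≤ᵇ (T₁.m<l⇒n≤3l h₁ m<h₁))) (T⇒≡true (≤⇒≤ᵇ (T₂.m<l⇒n≤3l (h₁ + x) m'<h₂)))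
      (dinvH-heights n h₁ x y total)
      (trans (areaH-heights h₁ (h₁ + x) h₁≤n h₁+x≤n) (cong₂ _+_ (∸-eq {b = suc m} h₁≡) (∸-eq {b = suc m'} h₂≡))))
    where
    open AtXY x y (≤-trans x+y≤m' m'≤n)
    lemma : ∀ {b₁ b₂ : Bool} {d d' a a' : ℕ} → b₁ ≡ true → b₂ ≡ true → d ≡ d' → a ≡ a' → ((b₁ ∧ b₂) ∧ g (d , a)) ≡ g (d' , a')
    lemma refl refl refl refl = refl
    ∸-eq : ∀ {a b c} → a ≡ c + b → a ∸ b ≡ c
    ∸-eq {b = b} {c} a≡ = trans (cong (_∸ b) a≡) (m+n∸n≡m c b)
    h₁≡ : h₁ ≡ (m' ∸ (x + y)) + suc m
    h₁≡ = +-cancelʳ-≡ (x + y) h₁ _ (trans h₁+[x+y]≡n (trans n≡m'+1+m (trans (cong (_+ suc m) (sym (m∸n+n≡m x+y≤m'))) (swap (m' ∸ (x + y)) (x + y) (suc m)))))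
      where
      swap : ∀ a b c → a + b + c ≡ a + c + b
      swap = solve-∀
    h₂≡ : h₁ + x ≡ (m ∸ y) + suc m'
    h₂≡ = +-cancelʳ-≡ y (h₁ + x) _ (trans total (trans n≡m'+1+m (trans (cong (λ z → m' + suc z) (sym (m∸n+n≡m y≤m))) (swap (m ∸ y) y m'))))
      where
      swap : ∀ a b c → c + suc (a + b) ≡ a + suc c + b
      swap = solve-∀
    m<h₁ : suc m ≤ h₁
    m<h₁ = subst (suc m ≤_) (sym h₁≡) (m≤n+m (suc m) _)
    m'<h₂ : suc m' ≤ h₁ + x
    m'<h₂ = subst (suc m' ≤_) (sym h₂≡) (m≤n+m (suc m') _)

  countᵇ-catalan3-weights : countᵇ g (catalan3 n) ≡ sumTo (suc m) (λ y → sumTo (suc m' ∸ y) (λ x → weight x y))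
  countᵇ-catalan3-weights = trans countᵇ-catalan3-xy (trans (sumTo-dropTail (suc m) (suc n) _ (s≤s (≤-trans m≤m' m'≤n)) yTooBig) (sumTo-cong (suc m) row))
    where
    x+y≤n : ∀ x y → y < suc n → x < suc n ∸ y → x + y ≤ n
    x+y≤n x y y< x< = ≤-pred (subst (x + y <_) (m∸n+n≡m (<⇒≤ y<)) (+-monoˡ-< y x<))
    yTooBig : ∀ y → suc m ≤ y → y < suc n → sumTo (suc n ∸ y) (λ x → countedAt x y) ≡ 0
    yTooBig y m<y y< = sumTo-zero (suc n ∸ y) (λ x x< → countedAt-beyond-y x y m<y (x+y≤n x y y< x<))
    row : ∀ y → y < suc m → sumTo (suc n ∸ y) (λ x → countedAt x y) ≡ sumTo (suc m' ∸ y) (λ x → weight x y)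
    row y y≤m = trans (sumTo-dropTail (suc m' ∸ y) (suc n ∸ y) _ (∸-monoˡ-≤ y (s≤s m'≤n)) xTooBig) (sumTo-cong (suc m' ∸ y) inside)
      where
      y≤1+m' : y ≤ suc m'
      y≤1+m' = ≤-trans (≤-pred y≤m) (≤-trans m≤m' (n≤1+n m'))
      xTooBig : ∀ x → suc m' ∸ y ≤ x → x < suc n ∸ y → countedAt x y ≡ 0
      xTooBig x le x< = countedAt-beyond-x+y x y (subst (_≤ x + y) (m∸n+n≡m y≤1+m') (+-monoˡ-≤ y le)) (x+y≤n x y (≤-trans y≤m (s≤s (≤-trans m≤m' m'≤n))) x<)
      inside : ∀ x → x < suc m' ∸ y → countedAt x y ≡ weight x y
      inside x x< = countedAt≡weight x y (≤-pred y≤m) (≤-pred (subst (x + y <_) (m∸n+n≡m y≤1+m') (+-monoˡ-< y x<)))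

  shallowSum crossingSum wideSum : ℕ → ℕ
  shallowSum  s = sumTo (suc (m ∸ s)) (λ x → weight x s)
  crossingSum s = sumTo (m ∸ s) (λ w → weight (suc (m ∸ (s + suc w)) + w) (s + suc w))
  wideSum     s = sumTo ((m ∸ s) + e) (λ w → weight (suc m + s) w)

  -- In row y the regimes are x ≤ m − y, m − y < x ≤ m and m < x; each is regrouped by s = n − 1 − area − dinv,
  -- which is y, m − x and x − m − 1 respectively.
  sumTo-weights-byRegime : sumTo (suc m) (λ y → sumTo (suc m' ∸ y) (λ x → weight x y)) ≡
                           sumTo (suc m) (λ s → shallowSum s + (crossingSum s + wideSum s))
  sumTo-weights-byRegime = begin
    sumTo (suc m) (λ y → sumTo (suc m' ∸ y) (λ x → weight x y))
      ≡⟨ sumTo-cong (suc m) splitRow ⟩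
    sumTo (suc m) (λ y → shallowSum y + (crossingRow y + wideRow y))
      ≡⟨ trans (sumTo-distrib (suc m) shallowSum (λ y → crossingRow y + wideRow y)) (cong (sumTo (suc m) shallowSum +_) (sumTo-distrib (suc m) crossingRow wideRow)) ⟩
    sumTo (suc m) shallowSum + (sumTo (suc m) crossingRow + sumTo (suc m) wideRow)
      ≡⟨ cong (λ z → sumTo (suc m) shallowSum + z) (cong₂ _+_ (sumTo-triangle-byGap m (λ v y → weight (suc (m ∸ y) + v) y))
                                                                (sumTo-triangle-transpose+ m e e≤1 (λ w y → weight (suc m + w) y))) ⟩
    sumTo (suc m) shallowSum + (sumTo (suc m) crossingSum + sumTo (suc m) wideSum)
      ≡⟨ trans (sumTo-distrib (suc m) shallowSum (λ y → crossingSum y + wideSum y)) (cong (sumTo (suc m) shallowSum +_) (sumTo-distrib (suc m) crossingSum wideSum)) ⟨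
    sumTo (suc m) (λ s → shallowSum s + (crossingSum s + wideSum s)) ∎
    where
    open ≡-Reasoning
    crossingRow wideRow : ℕ → ℕ
    crossingRow y = sumTo y (λ v → weight (suc (m ∸ y) + v) y)
    wideRow     y = sumTo ((m ∸ y) + e) (λ w → weight (suc m + w) y)
    splitRow : ∀ y → y < suc m → sumTo (suc m' ∸ y) (λ x → weight x y) ≡ shallowSum y + (crossingRow y + wideRow y)
    splitRow y y≤m = begin
      sumTo (suc m' ∸ y) f
        ≡⟨ cong (λ z → sumTo z f) rowLength ⟩
      sumTo (suc K + (y + (K + e))) f
        ≡⟨ sumTo-+ (suc K) (y + (K + e)) f ⟩
      sumTo (suc K) f + sumTo (y + (K + e)) (λ j → f (suc K + j))
        ≡⟨ cong (sumTo (suc K) f +_) (sumTo-+ y (K + e) (λ j → f (suc K + j))) ⟩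
      sumTo (suc K) f + (sumTo y (λ j → f (suc K + j)) + sumTo (K + e) (λ w → f (suc K + (y + w))))
        ≡⟨ cong (λ z → sumTo (suc K) f + (sumTo y (λ j → f (suc K + j)) + z)) (sumTo-cong (K + e) (λ w _ → cong (λ z → weight z y) (shift w))) ⟩
      shallowSum y + (crossingRow y + wideRow y) ∎
      where
      f : ℕ → ℕ
      f = λ x → weight x y
      K : ℕ
      K = m ∸ y
      K+y≡m : K + y ≡ m
      K+y≡m = m∸n+n≡m (≤-pred y≤m)
      rowLength : suc m' ∸ y ≡ suc K + (y + (K + e))
      rowLength = ≡+⇒∸≡ (trans (cong (λ z → suc (z + z + e)) (sym K+y≡m)) (identity K y e))
        where
        identity : ∀ K y e → suc (K + y + (K + y) + e) ≡ suc K + (y + (K + e)) + y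
        identity = solve-∀
      shift : ∀ w → suc K + (y + w) ≡ suc m + w
      shift w = trans (identity K y w) (cong (λ z → suc z + w) K+y≡m)
        where
        identity : ∀ K y w → suc K + (y + w) ≡ suc (K + y) + w
        identity = solve-∀

  -- For fixed s ≤ m the entries of rhs2 are a = s + t with t < 3L + 1 + e, L = m − s.  Read from the largest a down,
  -- the first L + 1 are shallow and the remaining ones alternate between crossing and wide.
  rhs2Entry : ℕ → ℕ → ℕ
  rhs2Entry s a = ind (rhs2Condition n s a ∧ g (n ∸ a ∸ s ∸ 1 , a))

  module Row (s : ℕ) (s≤m : s < suc m) where
    L : ℕ
    L = m ∸ s
    m≡s+L : m ≡ s + L
    m≡s+L = sym (m+[n∸m]≡n (≤-pred s≤m))
    width : ℕ
    width = suc L + (L + L + e)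
    n≡s+width+2s : n ≡ (s + width) + 2 * s
    n≡s+width+2s = trans n≡ (trans (cong (λ z → 3 * z + suc e) m≡s+L) (identity s L e))
      where
      identity : ∀ s L e → 3 * (s + L) + suc e ≡ s + (suc L + (L + L + e)) + 2 * s
      identity = solve-∀

    entryFrom : ℕ → ℕ
    entryFrom t = ind (g (n ∸ (s + t) ∸ s ∸ 1 , s + t))

    entryFromTop : ℕ → ℕ
    entryFromTop t' = entryFrom (width ∸ suc t')

    sumTo-entry : sumTo (suc n) (rhs2Entry s) ≡ sumTo width entryFrom
    sumTo-entry =
      trans (sumTo-dropTail (s + width) (suc n) (rhs2Entry s) (≤-trans (subst (s + width ≤_) (sym n≡s+width+2s) (m≤m+n (s + width) (2 * s))) (n≤1+n n)) aTooBig)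
        (trans (sumTo-dropHead s (s + width) (rhs2Entry s) (m≤m+n s width) aTooSmall)
          (trans (cong (λ z → sumTo z (λ t → rhs2Entry s (s + t))) (m+n∸m≡n s width)) (sumTo-cong width inRange)))
      where
      aTooBig : ∀ a → s + width ≤ a → a < suc n → rhs2Entry s a ≡ 0
      aTooBig a le _ = ind-false λ t → <-irrefl refl (≤-trans (+-monoˡ-≤ (2 * s) (s≤s le))
        (subst (suc a + 2 * s ≤_) n≡s+width+2s (subst (_≤ n) (identity a s) (≤ᵇ⇒≤ _ _ (∧-r {s ≤ᵇ a} (∧-l {rhs2Condition n s a} t))))))
        where
        identity : ∀ a s → a + 2 * s + 1 ≡ suc a + 2 * s
        identity = solve-∀
      aTooSmall : ∀ a → a < s → rhs2Entry s a ≡ 0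
      aTooSmall a a<s = ind-false λ t → <⇒≱ a<s (≤ᵇ⇒≤ _ _ (∧-l {s ≤ᵇ a} (∧-l {rhs2Condition n s a} t)))
      inRange : ∀ t → t < width → rhs2Entry s (s + t) ≡ entryFrom t
      inRange t t< = cong (λ b → ind (b ∧ g (n ∸ (s + t) ∸ s ∸ 1 , s + t))) (T⇒≡true (∧-intro (≤⇒≤ᵇ (m≤m+n s t))
        (≤⇒≤ᵇ (subst (s + t + 2 * s + 1 ≤_) (sym n≡s+width+2s) (subst (_≤ s + width + 2 * s) (identity s t) (+-monoˡ-≤ (2 * s) (+-monoʳ-< s t<)))))))
        where
        identity : ∀ s t → suc (s + t) + 2 * s ≡ s + t + 2 * s + 1
        identity = solve-∀

    sumTo-entryFrom-split : sumTo width entryFrom ≡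
      sumTo (suc L) entryFromTop + (sumTo L (λ w → entryFromTop (suc L + suc (w + w))) + sumTo (L + e) (λ w → entryFromTop (suc L + (w + w))))
    sumTo-entryFrom-split =
      trans (sumTo-reverse width entryFrom)
        (trans (sumTo-+ (suc L) (L + L + e) entryFromTop) (cong (sumTo (suc L) entryFromTop +_) (sumTo-oddEven L e e≤1 (λ j → entryFromTop (suc L + j)))))

    shallow : ∀ t' → t' < suc L → entryFromTop t' ≡ weight t' s
    shallow t' t'≤L with m≤n⇒∃[o]m+o≡n (≤-pred t'≤L)
    ... | q , t'+q≡L = let (dinvEq , areaEq) = rhsEntry-shallow n m e s L t' q n≡ m≡s+L (sym t'+q≡L)
                       in cong ind (cong g (cong₂ _,_ (trans dinvEq (sym dinvValue)) areaEq))
      where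
      t'+s≤m : t' + s ≤ m
      t'+s≤m = subst (t' + s ≤_) (trans (+-comm L s) (sym m≡s+L)) (+-monoˡ-≤ s (≤-pred t'≤L))
      dinvValue : dinvFormula n t' s ≡ t' + 0 + s
      dinvValue = cong₂ _+_ (cong₂ _+_ (sumTo-armZero-upTo t' (≤-trans (m≤m+n t' s) (≤-trans t'+s≤m (n≤1+n m)))) (sumTo-armOne-none t' s t'+s≤m))
                            (sumTo-armZero-upTo s (≤-trans (m≤n+m s t') (≤-trans t'+s≤m (n≤1+n m))))

    crossing : ∀ w → w < L → entryFromTop (suc L + suc (w + w)) ≡ weight (suc (m ∸ (s + suc w)) + w) (s + suc w)
    crossing w w<L with m≤n⇒∃[o]m+o≡n w<L
    ... | q , 1+w+q≡L = let (dinvEq , areaEq) = rhsEntry-crossing n m e s L w q n≡ m≡s+L (sym 1+w+q≡L)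
                        in cong ind (cong g (cong₂ _,_ (trans dinvEq (sym dinvValue)) areaEq))
      where
      m≡q+y : m ≡ q + (s + suc w)
      m≡q+y = trans m≡s+L (trans (cong (s +_) (sym 1+w+q≡L)) (identity s w q))
        where
        identity : ∀ s w q → s + suc (w + q) ≡ q + (s + suc w)
        identity = solve-∀
      x≡ : suc (m ∸ (s + suc w)) + w ≡ q + suc w
      x≡ = trans (cong (λ z → suc z + w) (≡+⇒∸≡ m≡q+y)) (sym (+-suc q w))
      x≤m : q + suc w ≤ m
      x≤m = subst (q + suc w ≤_) (trans (identity q w s) (sym m≡q+y)) (m≤m+n (q + suc w) s)
        where
        identity : ∀ q w s → q + suc w + s ≡ q + (s + suc w)
        identity = solve-∀
      dinvValue : dinvFormula n (suc (m ∸ (s + suc w)) + w) (s + suc w) ≡ suc (m ∸ (s + suc w)) + w + suc w + (s + suc w)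
      dinvValue = cong₂ _+_
        (cong₂ _+_ (sumTo-armZero-upTo _ (≤-trans (≤-reflexive x≡) (≤-trans x≤m (n≤1+n m))))
                   (trans (sumTo-cong (s + suc w) (λ v _ → cong (λ z → ind (dinvCondition n true 1 (z + v))) x≡)) (sumTo-armOne-crossing q w s m≡q+y)))
        (sumTo-armZero-upTo (s + suc w) (≤-trans (subst (s + suc w ≤_) (sym m≡q+y) (m≤n+m (s + suc w) q)) (n≤1+n m)))

    wide : ∀ w → w < L + e → entryFromTop (suc L + (w + w)) ≡ weight (suc m + s) w
    wide w w< = let (dinvEq , areaEq) = rhsEntry-wide n m e s L w e≤1 n≡ m≡s+L w<
                in cong ind (cong g (cong₂ _,_ (trans dinvEq (sym dinvValue)) areaEq))
      where
      s+w< : s + w < m + e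
      s+w< = subst (s + w <_) (trans (sym (+-assoc s L e)) (cong (_+ e) (sym m≡s+L))) (+-monoʳ-< s w<)
      w≤1+m : w ≤ suc m
      w≤1+m = ≤-trans (≤-pred (≤-trans w< (subst (L + e ≤_) (+-comm m 1) (+-mono-≤ (subst (L ≤_) (sym m≡s+L) (m≤n+m L s)) e≤1)))) (n≤1+n m)
      dinvValue : dinvFormula n (suc m + s) w ≡ suc m + w + w
      dinvValue = cong₂ _+_ (cong₂ _+_ (sumTo-armZero-beyond (suc m + s) (m≤m+n (suc m) s)) (sumTo-armOne-all s w s+w<))
                            (sumTo-armZero-upTo w w≤1+m)

    sumTo-row : sumTo (suc n) (rhs2Entry s) ≡ shallowSum s + (crossingSum s + wideSum s)
    sumTo-row = trans sumTo-entry (trans sumTo-entryFrom-split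
      (cong₂ _+_ (sumTo-cong (suc L) shallow) (cong₂ _+_ (sumTo-cong L crossing) (sumTo-cong (L + e) wide))))

  catalan3≡rhs2 : n / 3 ≡ m → countᵇ g (catalan3 n) ≡ countᵇ g (rhs2 n)
  catalan3≡rhs2 n/3≡m = begin
    countᵇ g (catalan3 n)                                                         ≡⟨ countᵇ-catalan3-weights ⟩
    sumTo (suc m) (λ y → sumTo (suc m' ∸ y) (λ x → weight x y))                   ≡⟨ sumTo-weights-byRegime ⟩
    sumTo (suc m) (λ s → shallowSum s + (crossingSum s + wideSum s))              ≡⟨ sumTo-cong (suc m) Row.sumTo-row ⟨
    sumTo (suc m) (λ s → sumTo (suc n) (rhs2Entry s))                             ≡⟨ cong (λ z → sumTo (suc z) (λ s → sumTo (suc n) (rhs2Entry s))) n/3≡m ⟨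
    sumTo (suc (n / 3)) (λ s → sumTo (suc n) (rhs2Entry s))                       ≡⟨ countᵇ-rhs2 n g ⟨
    countᵇ g (rhs2 n)                                                             ∎
    where open ≡-Reasoning

catalan3≋rhs2 : (n e : ℕ) → e ≤ 1 → n ≡ 3 * (n / 3) + suc e → catalan3 n ≋ rhs2 n
catalan3≋rhs2 n e e≤1 n≡ g = Counting.catalan3≡rhs2 n (n / 3) e n≡ e≤1 g refl

nonMultiple-of-3 : (n : ℕ) → ¬ (3 ∣ n) → ∃₂ λ e (_ : e ≤ 1) → n ≡ 3 * (n / 3) + suc e
nonMultiple-of-3 n 3∤n with n % 3 | m≡m%n+[m/n]*n n 3 | m%n<n n 3
... | zero  | n≡ | _               = ⊥-elim (3∤n (divides (n / 3) n≡))
... | suc e | n≡ | s≤s (s≤s e≤1) = e , e≤1 , trans n≡ (trans (+-comm (suc e) _) (cong (_+ suc e) (*-comm (n / 3) 3)))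

-- The hypothesis 1 ≤ n is implied by ¬ 3 ∣ n.
mainTheorem1 : (n : ℕ) → 1 ≤ n → ¬ (3 ∣ n) →
    (i j : ℕ) → (coeff (catalan3 n) i j ≡ coeff (rhs1 n) i j) × (coeff (rhs1 n) i j ≡ coeff (rhs2 n) i j)
mainTheorem1 n _ 3∤n i j with nonMultiple-of-3 n 3∤n
... | e , e≤1 , n≡ = ≋⇒coeff≡ {catalan3 n} {rhs1 n} catalan3≋rhs1 i j , ≋⇒coeff≡ {rhs1 n} {rhs2 n} (rhs1≋rhs2 n) i j
  where
  catalan3≋rhs1 : catalan3 n ≋ rhs1 n
  catalan3≋rhs1 g = trans (catalan3≋rhs2 n e e≤1 n≡ g) (sym (rhs1≋rhs2 n g))
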